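{- Let $n\ge 4$, $N=\{1,\dots,n\}$, let $i_1,i_2\in N$ with $i_1\ne i_2$, and let $\hat N^c=N\setminus\{i_1,i_2\}$. Then the inequality $$x_{i_2i_1}+\sum_{j\in\hat N^c}\left(x_{i_1j}+x_{ji_1}\right)-\sum_{j,j'\in\hat N^c:\ j\ne j'} x_{jj'}-\sum_{j\in\hat N^c}x_{i_2j}\ \le\ 2-\frac{(n-3)(n-4)}{2}$$ is facet defining for the weak order polytope $P^n_{WO}$.
   Context: Let $N=\{1,\dots,n\}$ and $A_N=\{(i,j): i,j\in N,\ i\ne j\}$. A weak order on $N$ is a binary relation $W\subseteq N\times N$ that is reflexive, transitive and total; $(i,j)\in W$ is read "$i$ is preferred over or tied with $j$". The characteristic vector of $W$ is $x^W\in\{0,1\}^{A_N}$ with $x^W_{ij}=1$ if $(i,j)\in W$ and $0$ otherwise. The weak order polytope $P^n_{WO}\subseteq\mathbb{R}^{A_N}$ is the convex hull of the characteristic vectors of all weak orders on $N$. An inequality $\pi x\le \pi_0$ is facet defining for a polytope $P$ if it is valid for $P$ and the face $P\cap\{x:\pi x=\pi_0\}$ is nonempty, different from $P$, and has dimension $\dim(P)-1$ (here $\dim P^n_{WO}=n(n-1)$).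
   Formalization: Points of $\mathbb{R}^{A_N}$ have rational coordinates only, and the convex-combination and affine-independence coefficients defining $P^n_{WO}$ and its dimensions are rational rather than real. -}

module Defs where

open import Data.Nat as ℕ using (ℕ; zero; suc; _∸_)
open import Data.Integer as ℤ using (ℤ; +_)
open import Data.Rational using (ℚ; 0ℚ; 1ℚ; _+_; _*_; _-_; -_; _≤_; _/_)
open import Data.Fin using (Fin; zero; suc)
open import Data.Fin.Properties using (_≟_)
open import Data.Bool using (Bool; true; false; if_then_else_; _∧_; not)
open import Data.Product using (Σ; ∃; _×_; _,_)
open import Data.Sum using (_⊎_)
open import Relation.Nullary using (¬_; ⌊_⌋)
open import Relation.Binary.PropositionalEquality using (_≡_; _≢_)

∑ : {m : ℕ} → (Fin m → ℚ) → ℚ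
∑ {zero}  f = 0ℚ
∑ {suc m} f = f zero + ∑ (λ k → f (suc k))

-- Points of ℝ^{A_N} (here with rational coordinates), represented as
-- functions Fin n → Fin n → ℚ; the diagonal entries are not coordinates
-- of A_N and are kept equal to 0 for every point of the polytope.
Pt : ℕ → Set
Pt n = Fin n → Fin n → ℚ

-- A weak order on N = Fin n, as a Boolean relation
-- (R i j ≡ true  means  "i is preferred over or tied with j").
record WeakOrder (n : ℕ) : Set where
  field
    R     : Fin n → Fin n → Bool
    refl  : ∀ i → R i i ≡ true
    trans : ∀ i j k → R i j ≡ true → R j k ≡ true → R i k ≡ true
    total : ∀ i j → R i j ≡ true ⊎ R j i ≡ true
open WeakOrder public

χ : {n : ℕ} → WeakOrder n → Pt n
χ W i j = if ⌊ i ≟ j ⌋ then 0ℚ else (if R W i j then 1ℚ else 0ℚ)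

InPWO : (n : ℕ) → Pt n → Set
InPWO n x =
  Σ ℕ λ m → Σ (Fin m → ℚ) λ μ → Σ (Fin m → WeakOrder n) λ W →
    (∀ k → 0ℚ ≤ μ k) × (∑ μ ≡ 1ℚ) ×
    (∀ i j → x i j ≡ ∑ (λ k → μ k * χ (W k) i j))

dot : {n : ℕ} → Pt n → Pt n → ℚ
dot {n} π x = ∑ (λ i → ∑ (λ j → if ⌊ i ≟ j ⌋ then 0ℚ else π i j * x i j))

AffinelyIndependent : {n m : ℕ} → (Fin m → Pt n) → Set
AffinelyIndependent {n} {m} p =
  (c : Fin m → ℚ) → ∑ c ≡ 0ℚ →
  (∀ i j → ∑ (λ k → c k * p k i j) ≡ 0ℚ) → ∀ k → c k ≡ 0ℚ

HasDim : {n : ℕ} → (Pt n → Set) → ℕ → Set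
HasDim {n} S d =
  (Σ (Fin (suc d) → Pt n) λ p → (∀ k → S (p k)) × AffinelyIndependent p) ×
  ((p : Fin (suc (suc d)) → Pt n) → (∀ k → S (p k)) → ¬ AffinelyIndependent p)

FacetDefining : {n : ℕ} → (Pt n → Set) → Pt n → ℚ → Set
FacetDefining {n} P π π₀ =
  (∀ x → P x → dot π x ≤ π₀) ×
  (Σ (Pt n) λ x → P x × dot π x ≡ π₀) ×
  (Σ (Pt n) λ x → P x × ¬ (dot π x ≡ π₀)) ×
  (Σ ℕ λ d → HasDim P (suc d) × HasDim F d)
  where
    F : Pt n → Set
    F x = P x × dot π x ≡ π₀

inNc : {n : ℕ} → Fin n → Fin n → Fin n → Bool
inNc i₁ i₂ j = not ⌊ j ≟ i₁ ⌋ ∧ not ⌊ j ≟ i₂ ⌋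

πthm : {n : ℕ} → Fin n → Fin n → Pt n
πthm i₁ i₂ i j =
  if ⌊ i ≟ j ⌋ then 0ℚ else
  if ⌊ i ≟ i₂ ⌋ ∧ ⌊ j ≟ i₁ ⌋ then 1ℚ else
  if ⌊ i ≟ i₁ ⌋ ∧ inNc i₁ i₂ j then 1ℚ else
  if inNc i₁ i₂ i ∧ ⌊ j ≟ i₁ ⌋ then 1ℚ else
  if inNc i₁ i₂ i ∧ inNc i₁ i₂ j then - 1ℚ else
  if ⌊ i ≟ i₂ ⌋ ∧ inNc i₁ i₂ j then - 1ℚ else
  0ℚ

rhsthm : ℕ → ℚ
rhsthm n = (+ 2 / 1) - (+ ((n ∸ 3) ℕ.* (n ∸ 4)) / 2)

-- Up to a permutation of the ground set, N̂ᶜ = {0, …, m - 1}, i₂ = m and i₁ = m + 1 with n = m + 2.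
-- Validity follows by induction on m, adding the first element of N̂ᶜ, when proved together with the
-- sharper bound π x ≤ rhs - 1 + x_{i₂ i₁} for weak orders in which no element of N̂ᶜ is tied with i₁.
-- For the dimension one builds n(n-1) + 1 weak orders whose characteristic vectors, homogenised by a
-- coordinate 1, span ℚ^{1+n(n-1)}, the first off the face and all others on it. For n = 4 they are
-- listed explicitly; from n to n + 1 the old ones are put below a new top element, and 2n new weak
-- orders on the face span the coordinates of the 2n new arcs. Linear independence of homogenised
-- vectors is affine independence, and the count bounds the dimensions of the polytope and of the face
-- (whose hyperplane misses the origin since the right-hand side is nonzero).

module Submission where

open import Defs hiding (refl; trans; total)
open import Data.Nat as ℕ using (ℕ; zero; suc; z≤n; s≤s)
import Data.Nat.Properties as ℕP
open import Data.Nat.Solver using () renaming (module +-*-Solver to ℕSolver)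
import Data.Integer as ℤ
import Data.Integer.Properties as ℤP
open import Data.Integer.Solver using () renaming (module +-*-Solver to ℤSolver)
open import Data.Rational as ℚ using (ℚ; 0ℚ; 1ℚ; _+_; _*_; _-_; -_; _/_; _≤_; 1/_)
import Data.Rational.Properties as ℚP
open import Data.Rational.Solver using (module +-*-Solver)
import Data.Rational.Unnormalised as ℚᵘ
import Data.Rational.Unnormalised.Properties as ℚᵘP
open import Data.Fin using (Fin; zero; suc; toℕ; fromℕ; fromℕ<; punchIn; splitAt; _↑ˡ_; _↑ʳ_)
open import Data.Fin.Properties
  using (_≟_; suc-injective; toℕ<n; toℕ-fromℕ; toℕ-fromℕ<; punchInᵢ≢i; all?; any?; ¬∀⟶∃¬;
         splitAt-↑ˡ; splitAt-↑ʳ; splitAt⁻¹-↑ˡ; splitAt⁻¹-↑ʳ)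
open import Data.Fin.Permutation as Perm using (Permutation′; _⟨$⟩ʳ_; _⟨$⟩ˡ_; inverseˡ; inverseʳ; _∘ₚ_)
open import Data.Bool as 𝔹 using (Bool; true; false; if_then_else_; _∧_; not)
import Data.Bool.Properties as 𝔹P
open import Data.Product using (Σ; _×_; _,_; proj₁; proj₂)
open import Data.Sum using (_⊎_; inj₁; inj₂; [_,_]′)
open import Data.Empty using (⊥-elim)
open import Data.Vec using (Vec; _∷_; []; lookup)
open import Data.Vec.Functional using (insertAt)
open import Data.Vec.Functional.Properties using (insertAt-lookup; insertAt-punchIn)
open import Function using (_∘_)
open import Relation.Nullary using (¬_; yes; no; ⌊_⌋)
open import Relation.Nullary.Decidable using (toWitness; dec-true; dec-false)
open import Relation.Binary.PropositionalEquality
open import Algebra.Bundles using (Ring)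
open import Algebra.Properties.Group ℚP.+-0-group using () renaming (∙-cancelʳ to +-cancelʳ)
import Algebra.Properties.Semiring.Sum as SemiringSum
open +-*-Solver

-- Finite sums

open SemiringSum (Ring.semiring ℚP.+-*-ring)
  using (sum; sum-remove; sum-permute; *-distribˡ-sum; *-distribʳ-sum)
  renaming (∑-distrib-+ to sum-distrib-+; ∑-comm to sum-comm)

-- Defs' ∑ unfolds like the library's sum but is not definitionally equal to it for variable m.
∑≡sum : ∀ {m} (f : Fin m → ℚ) → ∑ f ≡ sum f
∑≡sum {zero}  f = refl
∑≡sum {suc m} f = cong (f zero +_) (∑≡sum (λ k → f (suc k)))

∑-cong : ∀ {m} {f g : Fin m → ℚ} → (∀ k → f k ≡ g k) → ∑ f ≡ ∑ g
∑-cong {zero}  h = refl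
∑-cong {suc m} h = cong₂ _+_ (h zero) (∑-cong (λ k → h (suc k)))

∑-zero : ∀ {m} {f : Fin m → ℚ} → (∀ k → f k ≡ 0ℚ) → ∑ f ≡ 0ℚ
∑-zero {zero}  h = refl
∑-zero {suc m} h = trans (cong₂ _+_ (h zero) (∑-zero (λ k → h (suc k)))) (ℚP.+-identityˡ 0ℚ)

∑-distrib-+ : ∀ {m} (f g : Fin m → ℚ) → ∑ (λ k → f k + g k) ≡ ∑ f + ∑ g
∑-distrib-+ f g =
  trans (∑≡sum (λ k → f k + g k)) (trans (sum-distrib-+ f g) (sym (cong₂ _+_ (∑≡sum f) (∑≡sum g))))

*-distribˡ-∑ : ∀ {m} a (f : Fin m → ℚ) → a * ∑ f ≡ ∑ (λ k → a * f k)
*-distribˡ-∑ a f = trans (cong (a *_) (∑≡sum f)) (trans (*-distribˡ-sum a f) (sym (∑≡sum (λ k → a * f k))))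

*-distribʳ-∑ : ∀ {m} a (f : Fin m → ℚ) → ∑ f * a ≡ ∑ (λ k → f k * a)
*-distribʳ-∑ a f = trans (cong (_* a) (∑≡sum f)) (trans (*-distribʳ-sum a f) (sym (∑≡sum (λ k → f k * a))))

∑-comm : ∀ {m n} (f : Fin m → Fin n → ℚ) → ∑ (λ i → ∑ (f i)) ≡ ∑ (λ j → ∑ (λ i → f i j))
∑-comm f = trans (∑-cong (λ i → ∑≡sum (f i))) (trans (∑≡sum (λ i → sum (f i))) (trans (sum-comm f)
  (sym (trans (∑-cong (λ j → ∑≡sum (λ i → f i j))) (∑≡sum (λ j → sum (λ i → f i j)))))))

∑-remove : ∀ {m} (p : Fin (suc m)) (f : Fin (suc m) → ℚ) → ∑ f ≡ f p + ∑ (λ k → f (punchIn p k))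
∑-remove p f = trans (∑≡sum f) (trans (sum-remove {i = p} f) (cong (f p +_) (sym (∑≡sum (λ k → f (punchIn p k))))))

∑-permute : ∀ {m} (σ : Permutation′ m) (f : Fin m → ℚ) → ∑ (λ i → f (σ ⟨$⟩ʳ i)) ≡ ∑ f
∑-permute σ f = trans (∑≡sum (λ i → f (σ ⟨$⟩ʳ i))) (trans (sym (sum-permute f σ)) (sym (∑≡sum f)))

∑-neg : ∀ {m} (f : Fin m → ℚ) → ∑ (λ k → - f k) ≡ - ∑ f
∑-neg {zero}  f = refl
∑-neg {suc m} f = trans (cong (- f zero +_) (∑-neg (λ k → f (suc k))))
  (sym (ℚP.neg-distrib-+ (f zero) _))

∑-nonNeg : ∀ {m} (f : Fin m → ℚ) → (∀ k → 0ℚ ≤ f k) → 0ℚ ≤ ∑ f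
∑-nonNeg {zero}  f h = ℚP.≤-refl
∑-nonNeg {suc m} f h = ℚP.+-mono-≤ (h zero) (∑-nonNeg (λ k → f (suc k)) (λ k → h (suc k)))

∑-mono-≤ : ∀ {m} {f g : Fin m → ℚ} → (∀ k → f k ≤ g k) → ∑ f ≤ ∑ g
∑-mono-≤ {zero}  h = ℚP.≤-refl
∑-mono-≤ {suc m} h = ℚP.+-mono-≤ (h zero) (∑-mono-≤ (λ k → h (suc k)))

term≤∑ : ∀ {m} (f : Fin m → ℚ) → (∀ k → 0ℚ ≤ f k) → ∀ p → f p ≤ ∑ f
term≤∑ {suc m} f h zero = ℚP.≤-trans (ℚP.≤-reflexive (sym (ℚP.+-identityʳ (f zero))))
  (ℚP.+-monoʳ-≤ (f zero) (∑-nonNeg (λ k → f (suc k)) (λ k → h (suc k))))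
term≤∑ {suc m} f h (suc p) = ℚP.≤-trans (ℚP.≤-reflexive (sym (ℚP.+-identityˡ (f (suc p)))))
  (ℚP.+-mono-≤ (h zero) (term≤∑ (λ k → f (suc k)) (λ k → h (suc k)) p))

⌊yes⌋ : ∀ {n} {x y : Fin n} → x ≡ y → ⌊ x ≟ y ⌋ ≡ true
⌊yes⌋ {x = x} {y} x≡y with x ≟ y
... | yes _  = refl
... | no x≢y = ⊥-elim (x≢y x≡y)

⌊refl⌋ : ∀ {n} (x : Fin n) → ⌊ x ≟ x ⌋ ≡ true
⌊refl⌋ x = ⌊yes⌋ refl

⌊no⌋ : ∀ {n} {x y : Fin n} → x ≢ y → ⌊ x ≟ y ⌋ ≡ false
⌊no⌋ {x = x} {y} x≢y with x ≟ y
... | yes x≡y = ⊥-elim (x≢y x≡y)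
... | no _    = refl

⌊suc⌋ : ∀ {n} (x y : Fin n) → ⌊ suc x ≟ suc y ⌋ ≡ ⌊ x ≟ y ⌋
⌊suc⌋ x y with x ≟ y
... | yes _ = refl
... | no _  = refl

basis : ∀ {M} → Fin M → Fin M → ℚ
basis s t = if ⌊ s ≟ t ⌋ then 1ℚ else 0ℚ

basis-sym : ∀ {M} (s t : Fin M) → basis s t ≡ basis t s
basis-sym s t with s ≟ t | t ≟ s
... | yes _   | yes _   = refl
... | no _    | no _    = refl
... | yes s≡t | no t≢s  = ⊥-elim (t≢s (sym s≡t))
... | no s≢t  | yes t≡s = ⊥-elim (s≢t (sym t≡s))

basis-diag : ∀ {M} (s : Fin M) → basis s s ≡ 1ℚ
basis-diag s = cong (if_then 1ℚ else 0ℚ) (⌊refl⌋ s)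

basis-off : ∀ {M} {s t : Fin M} → s ≢ t → basis s t ≡ 0ℚ
basis-off s≢t = cong (if_then 1ℚ else 0ℚ) (⌊no⌋ s≢t)

∑-basisʳ : ∀ {M} (d : Fin M → ℚ) (t : Fin M) → ∑ (λ s → d s * basis s t) ≡ d t
∑-basisʳ {suc M} d t = begin
  ∑ (λ s → d s * basis s t)                  ≡⟨ ∑-remove t (λ s → d s * basis s t) ⟩
  d t * basis t t + ∑ (λ k → d (pt k) * basis (pt k) t)
    ≡⟨ cong₂ _+_ (trans (cong (d t *_) (basis-diag t)) (ℚP.*-identityʳ (d t)))
                 (∑-zero (λ k → trans (cong (d (pt k) *_) (basis-off (punchInᵢ≢i t k))) (ℚP.*-zeroʳ (d (pt k))))) ⟩
  d t + 0ℚ                                    ≡⟨ ℚP.+-identityʳ (d t) ⟩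
  d t                                         ∎
  where
  open ≡-Reasoning
  pt = punchIn t

∑-basisˡ : ∀ {M} (s : Fin M) (f : Fin M → ℚ) → ∑ (λ t → basis s t * f t) ≡ f s
∑-basisˡ s f = trans (∑-cong (λ t → trans (ℚP.*-comm _ (f t)) (cong (f t *_) (basis-sym s t)))) (∑-basisʳ f s)

-- Linear algebra over ℚ

lincomb : ∀ {K M} → (Fin K → ℚ) → (Fin K → Fin M → ℚ) → Fin M → ℚ
lincomb c u t = ∑ (λ k → c k * u k t)

LinearlyDependent : ∀ {K M} → (Fin K → Fin M → ℚ) → Set
LinearlyDependent {K} u =
  Σ (Fin K → ℚ) λ c → (∀ t → lincomb c u t ≡ 0ℚ) × Σ (Fin K) (λ k → c k ≢ 0ℚ)

InSpan : ∀ {K M} → (Fin K → Fin M → ℚ) → (Fin M → ℚ) → Set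
InSpan {K} u v = Σ (Fin K → ℚ) λ β → ∀ t → v t ≡ lincomb β u t

*-cancelˡ-≡0 : ∀ {a b} → a ≢ 0ℚ → a * b ≡ 0ℚ → b ≡ 0ℚ
*-cancelˡ-≡0 {a} {b} a≢0 ab≡0 = begin
  b                 ≡⟨ sym (ℚP.*-identityˡ b) ⟩
  1ℚ * b            ≡⟨ cong (_* b) (sym (ℚP.*-inverseˡ a)) ⟩
  (1/ a) * a * b    ≡⟨ ℚP.*-assoc (1/ a) a b ⟩
  (1/ a) * (a * b)  ≡⟨ cong ((1/ a) *_) ab≡0 ⟩
  (1/ a) * 0ℚ       ≡⟨ ℚP.*-zeroʳ (1/ a) ⟩
  0ℚ                ∎
  where
  open ≡-Reasoning
  instance _ = ℚ.≢-nonZero a≢0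

*-≢0 : ∀ {a b} → a ≢ 0ℚ → b ≢ 0ℚ → a * b ≢ 0ℚ
*-≢0 a≢0 b≢0 ab≡0 = b≢0 (*-cancelˡ-≡0 a≢0 ab≡0)

lincomb-assoc : ∀ {I K M} (d : Fin I → ℚ) (v : Fin I → Fin K → ℚ) (u : Fin K → Fin M → ℚ) t →
  lincomb (lincomb d v) u t ≡ lincomb d (λ i → lincomb (v i) u) t
lincomb-assoc d v u t = begin
  ∑ (λ k → ∑ (λ i → d i * v i k) * u k t)    ≡⟨ ∑-cong (λ k → *-distribʳ-∑ (u k t) (λ i → d i * v i k)) ⟩
  ∑ (λ k → ∑ (λ i → d i * v i k * u k t))    ≡⟨ ∑-comm (λ k i → d i * v i k * u k t) ⟩
  ∑ (λ i → ∑ (λ k → d i * v i k * u k t))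
    ≡⟨ ∑-cong (λ i → trans (∑-cong (λ k → ℚP.*-assoc (d i) (v i k) (u k t)))
                             (sym (*-distribˡ-∑ (d i) (λ k → v i k * u k t)))) ⟩
  ∑ (λ i → d i * ∑ (λ k → v i k * u k t))    ∎
  where open ≡-Reasoning

module _ {K M : ℕ} (u : Fin (suc K) → Fin (suc M) → ℚ) where

  zeroColumn-dependent : (∀ k → u k zero ≡ 0ℚ) →
    LinearlyDependent (λ k t → u k (suc t)) → LinearlyDependent u
  zeroColumn-dependent u₀≡0 (c , c∙u≡0 , nz) = c , c∙u≡0′ , nz
    where
    c∙u≡0′ : ∀ t → lincomb c u t ≡ 0ℚ
    c∙u≡0′ zero    = ∑-zero (λ k → trans (cong (c k *_) (u₀≡0 k)) (ℚP.*-zeroʳ (c k)))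
    c∙u≡0′ (suc t) = c∙u≡0 t

  module _ (p : Fin (suc K)) (a≢0 : u p zero ≢ 0ℚ) where

    private
      a = u p zero

    eliminated : Fin K → Fin M → ℚ
    eliminated k t = a * u (punchIn p k) (suc t) - u (punchIn p k) zero * u p (suc t)

    -- The dependence a · c′ on the non-pivot vectors is completed at the pivot by cp, which is
    -- chosen to cancel the first coordinate.
    pivot-dependent : LinearlyDependent eliminated → LinearlyDependent u
    pivot-dependent (c′ , c′∙elim≡0 , k₀ , c′k₀≢0) = c , c∙u≡0 , punchIn p k₀ , ck₀≢0
      where
      pI = punchIn p
      cp = - ∑ (λ k → c′ k * u (pI k) zero)
      c : Fin (suc K) → ℚ
      c = insertAt (λ k → a * c′ k) p cp
      c-punchIn : ∀ k → c (pI k) ≡ a * c′ k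
      c-punchIn = insertAt-punchIn (λ k → a * c′ k) p cp
      ck₀≢0 : c (pI k₀) ≢ 0ℚ
      ck₀≢0 e = *-≢0 a≢0 c′k₀≢0 (trans (sym (c-punchIn k₀)) e)
      split : ∀ t → lincomb c u t ≡ cp * u p t + ∑ (λ k → a * (c′ k * u (pI k) t))
      split t = trans (∑-remove p (λ k → c k * u k t))
        (cong₂ _+_ (cong (_* u p t) (insertAt-lookup (λ k → a * c′ k) p cp))
                   (∑-cong λ k → trans (cong (_* u (pI k) t) (c-punchIn k)) (ℚP.*-assoc a (c′ k) _)))
      c∙u≡0 : ∀ t → lincomb c u t ≡ 0ℚ
      c∙u≡0 zero = begin
        lincomb c u zero                     ≡⟨ split zero ⟩
        cp * a + ∑ (λ k → a * (c′ k * u (pI k) zero))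
          ≡⟨ cong (cp * a +_) (sym (*-distribˡ-∑ a (λ k → c′ k * u (pI k) zero))) ⟩
        - S * a + a * S                      ≡⟨ solve 2 (λ S a → (:- S) :* a :+ a :* S := con 0ℚ) refl S a ⟩
        0ℚ                                   ∎
        where
        open ≡-Reasoning
        S = ∑ (λ k → c′ k * u (pI k) zero)
      c∙u≡0 (suc t) = begin
        lincomb c u (suc t)                 ≡⟨ split (suc t) ⟩
        cp * y + ∑ (λ k → a * (c′ k * u (pI k) (suc t)))
          ≡⟨ cong (_+ ∑ (λ k → a * (c′ k * u (pI k) (suc t))))
               (trans (cong (_* y) (sym (∑-neg (λ k → c′ k * u (pI k) zero))))
                      (*-distribʳ-∑ y (λ k → - (c′ k * u (pI k) zero)))) ⟩
        ∑ (λ k → - (c′ k * u (pI k) zero) * y) + ∑ (λ k → a * (c′ k * u (pI k) (suc t)))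
          ≡⟨ sym (∑-distrib-+ (λ k → - (c′ k * u (pI k) zero) * y) (λ k → a * (c′ k * u (pI k) (suc t)))) ⟩
        ∑ (λ k → - (c′ k * u (pI k) zero) * y + a * (c′ k * u (pI k) (suc t)))
          ≡⟨ ∑-cong (λ k → solve 5 (λ y c x a b → (:- (c :* x)) :* y :+ a :* (c :* b) := c :* (a :* b :- x :* y))
                                   refl y (c′ k) (u (pI k) zero) a (u (pI k) (suc t))) ⟩
        lincomb c′ eliminated t             ≡⟨ c′∙elim≡0 t ⟩
        0ℚ                                  ∎
        where
        open ≡-Reasoning
        y = u p (suc t)

<⇒linearlyDependent : ∀ M K → M ℕ.< K → (u : Fin K → Fin M → ℚ) → LinearlyDependent u
<⇒linearlyDependent zero    (suc K) _          u = (λ _ → 1ℚ) , (λ ()) , zero , λ ()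
<⇒linearlyDependent (suc M) (suc K) (s≤s M<K) u with all? (λ k → u k zero ℚP.≟ 0ℚ)
... | yes u₀≡0 = zeroColumn-dependent u u₀≡0
                   (<⇒linearlyDependent M (suc K) (ℕP.m<n⇒m<1+n M<K) (λ k t → u k (suc t)))
... | no u₀≢0 with ¬∀⟶∃¬ _ _ (λ k → u k zero ℚP.≟ 0ℚ) u₀≢0
...   | p , a≢0 = pivot-dependent u p a≢0 (<⇒linearlyDependent M K M<K (eliminated u p a≢0))

-- A dependence between c and the coefficient vectors of the basis, multiplied out by u, forces all
-- of its coefficients to vanish.
spanning⇒independent : ∀ {M} (u : Fin M → Fin M → ℚ) → (∀ s → InSpan u (basis s)) →
  ∀ c → (∀ t → lincomb c u t ≡ 0ℚ) → ∀ k → c k ≡ 0ℚ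
spanning⇒independent {M} u span c c∙u≡0 k = *-cancelˡ-≡0 d₀≢0 d₀ck≡0
  where
  β : Fin M → Fin M → ℚ
  β s = proj₁ (span s)
  v : Fin (suc M) → Fin M → ℚ
  v zero    = c
  v (suc s) = β s
  dependence = <⇒linearlyDependent M (suc M) (ℕP.n<1+n M) v
  d = proj₁ dependence
  d∙v≡0 = proj₁ (proj₂ dependence)
  dₛ≡0 : ∀ s → d (suc s) ≡ 0ℚ
  dₛ≡0 s = begin
    d (suc s)                                              ≡⟨ sym (∑-basisʳ (λ r → d (suc r)) s) ⟩
    ∑ (λ r → d (suc r) * basis r s)                        ≡⟨ ∑-cong (λ r → cong (d (suc r) *_) (proj₂ (span r) s)) ⟩
    ∑ (λ r → d (suc r) * lincomb (β r) u s)                ≡⟨ sym (ℚP.+-identityˡ _) ⟩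
    0ℚ + ∑ (λ r → d (suc r) * lincomb (β r) u s)
      ≡⟨ cong (_+ ∑ (λ r → d (suc r) * lincomb (β r) u s))
              (sym (trans (cong (d zero *_) (c∙u≡0 s)) (ℚP.*-zeroʳ (d zero)))) ⟩
    lincomb d (λ i → lincomb (v i) u) s                    ≡⟨ sym (lincomb-assoc d v u s) ⟩
    lincomb (lincomb d v) u s                              ≡⟨ ∑-zero (λ t → trans (cong (_* u t s) (d∙v≡0 t)) (ℚP.*-zeroˡ (u t s))) ⟩
    0ℚ                                                     ∎
    where open ≡-Reasoning
  d₀≢0 : d zero ≢ 0ℚ
  d₀≢0 with proj₂ (proj₂ dependence)
  ... | zero  , d₀≢0 = d₀≢0
  ... | suc s , dₛ≢0 = ⊥-elim (dₛ≢0 (dₛ≡0 s))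
  d₀ck≡0 : d zero * c k ≡ 0ℚ
  d₀ck≡0 = begin
    d zero * c k                                   ≡⟨ sym (ℚP.+-identityʳ _) ⟩
    d zero * c k + 0ℚ                              ≡⟨ cong (d zero * c k +_) (sym (∑-zero (λ s →
                                                        trans (cong (_* β s k) (dₛ≡0 s)) (ℚP.*-zeroˡ (β s k))))) ⟩
    lincomb d v k                                  ≡⟨ d∙v≡0 k ⟩
    0ℚ                                             ∎
    where open ≡-Reasoning

data Span {K M : ℕ} (u : Fin K → Fin M → ℚ) : (Fin M → ℚ) → Set where
  gen  : ∀ k → Span u (u k)
  zer  : Span u (λ _ → 0ℚ)
  lin  : ∀ c {v w} → Span u v → Span u w → Span u (λ t → c * v t + w t)
  ext  : ∀ {v w} → (∀ t → v t ≡ w t) → Span u v → Span u w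

module _ {K M : ℕ} {u : Fin K → Fin M → ℚ} where

  span-+ : ∀ {v w} → Span u v → Span u w → Span u (λ t → v t + w t)
  span-+ {v} {w} sv sw = ext (λ t → cong (_+ w t) (ℚP.*-identityˡ (v t))) (lin 1ℚ sv sw)

  span-* : ∀ c {v} → Span u v → Span u (λ t → c * v t)
  span-* c {v} sv = ext (λ t → ℚP.+-identityʳ (c * v t)) (lin c sv zer)

  span-minus : ∀ {v w} → Span u v → Span u w → Span u (λ t → v t - w t)
  span-minus {v} {w} sv sw =
    span-+ sv (ext (λ t → solve 1 (λ x → (:- con 1ℚ) :* x := :- x) refl (w t)) (span-* (- 1ℚ) sw))

  span-∑ : ∀ {L} (f : Fin L → Fin M → ℚ) → (∀ l → Span u (f l)) → Span u (λ t → ∑ (λ l → f l t))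
  span-∑ {zero}  f h = zer
  span-∑ {suc L} f h = span-+ (h zero) (span-∑ (λ l → f (suc l)) (λ l → h (suc l)))

  basis⇒span : (∀ s → Span u (basis s)) → ∀ v → Span u v
  basis⇒span h v = ext (λ t → ∑-basisʳ v t)
    (span-∑ (λ s t → v s * basis s t) (λ s → span-* (v s) (h s)))

  Span⇒InSpan : ∀ {v} → Span u v → InSpan u v
  Span⇒InSpan (gen k) = basis k , λ t → sym (∑-basisˡ k (λ j → u j t))
  Span⇒InSpan zer = (λ _ → 0ℚ) , λ t → sym (∑-zero (λ k → ℚP.*-zeroˡ (u k t)))
  Span⇒InSpan (lin c sv sw) with Span⇒InSpan sv | Span⇒InSpan sw
  ... | β₁ , v≡β₁u | β₂ , w≡β₂u = (λ k → c * β₁ k + β₂ k) , λ t → begin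
    c * _ + _                                    ≡⟨ cong₂ (λ x y → c * x + y) (v≡β₁u t) (w≡β₂u t) ⟩
    c * lincomb β₁ u t + lincomb β₂ u t
      ≡⟨ cong (_+ lincomb β₂ u t) (*-distribˡ-∑ c (λ k → β₁ k * u k t)) ⟩
    ∑ (λ k → c * (β₁ k * u k t)) + lincomb β₂ u t
      ≡⟨ sym (∑-distrib-+ (λ k → c * (β₁ k * u k t)) (λ k → β₂ k * u k t)) ⟩
    ∑ (λ k → c * (β₁ k * u k t) + β₂ k * u k t)
      ≡⟨ ∑-cong (λ k → solve 4 (λ c b₁ b₂ x → c :* (b₁ :* x) :+ b₂ :* x := (c :* b₁ :+ b₂) :* x)
                                refl c (β₁ k) (β₂ k) (u k t)) ⟩
    lincomb (λ k → c * β₁ k + β₂ k) u t          ∎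
    where open ≡-Reasoning
  Span⇒InSpan (ext v≡w sv) with Span⇒InSpan sv
  ... | β , v≡βu = β , λ t → trans (sym (v≡w t)) (v≡βu t)

Span-mono : ∀ {K K′ M} {u : Fin K → Fin M → ℚ} {u′ : Fin K′ → Fin M → ℚ} →
  (∀ k → Span u′ (u k)) → ∀ {v} → Span u v → Span u′ v
Span-mono h (gen k)       = h k
Span-mono h zer           = zer
Span-mono h (lin c sv sw) = lin c (Span-mono h sv) (Span-mono h sw)
Span-mono h (ext v≡w sv)  = ext v≡w (Span-mono h sv)

record IsLinear {M M′ : ℕ} (L : (Fin M → ℚ) → Fin M′ → ℚ) : Set where
  field
    cong-pointwise : ∀ {v w} → (∀ t → v t ≡ w t) → ∀ t → L v t ≡ L w t
    map-zero       : ∀ t → L (λ _ → 0ℚ) t ≡ 0ℚ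
    map-lin        : ∀ c v w t → L (λ s → c * v s + w s) t ≡ c * L v t + L w t

Span-map : ∀ {K M M′} {u : Fin K → Fin M → ℚ} {L : (Fin M → ℚ) → Fin M′ → ℚ} → IsLinear L →
  ∀ {v} → Span u v → Span (λ k → L (u k)) (L v)
Span-map isL (gen k)               = gen k
Span-map isL zer                   = ext (λ t → sym (IsLinear.map-zero isL t)) zer
Span-map isL (lin c {v} {w} sv sw) =
  ext (λ t → sym (IsLinear.map-lin isL c v w t)) (lin c (Span-map isL sv) (Span-map isL sw))
Span-map isL (ext v≡w sv)          = ext (IsLinear.cong-pointwise isL v≡w) (Span-map isL sv)

-- The inequality in canonical position

𝟙 : Bool → ℚ
𝟙 b = if b then 1ℚ else 0ℚ

𝟙-nonNeg : ∀ b → 0ℚ ≤ 𝟙 b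
𝟙-nonNeg true  = ℚ.*≤* (ℤ.+≤+ z≤n)
𝟙-nonNeg false = ℚP.≤-refl

𝟙≤1 : ∀ b → 𝟙 b ≤ 1ℚ
𝟙≤1 true  = ℚP.≤-refl
𝟙≤1 false = 𝟙-nonNeg true

-- πthm i₁ i₂ i j is definitionally πᵇ applied to the tests i = j, i = i₁, i = i₂, j = i₁, j = i₂.
πᵇ : Bool → Bool → Bool → Bool → Bool → ℚ
πᵇ e ia ib ja jb =
  if e then 0ℚ else
  if ib ∧ ja then 1ℚ else
  if ia ∧ (not ja ∧ not jb) then 1ℚ else
  if (not ia ∧ not ib) ∧ ja then 1ℚ else
  if (not ia ∧ not ib) ∧ (not ja ∧ not jb) then - 1ℚ else
  if ib ∧ (not ja ∧ not jb) then - 1ℚ else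
  0ℚ

πthm-suc : ∀ {n} (a b i j : Fin n) → πthm (suc a) (suc b) (suc i) (suc j) ≡ πthm a b i j
πthm-suc a b i j
  rewrite ⌊suc⌋ i j | ⌊suc⌋ i a | ⌊suc⌋ i b | ⌊suc⌋ j a | ⌊suc⌋ j b = refl

dot-cong : ∀ {n} {π π′ x x′ : Pt n} → (∀ i j → π i j ≡ π′ i j) → (∀ i j → x i j ≡ x′ i j) →
  dot π x ≡ dot π′ x′
dot-cong π≡ x≡ = ∑-cong (λ i → ∑-cong (λ j → cong₂ (λ p y → if ⌊ i ≟ j ⌋ then 0ℚ else p * y) (π≡ i j) (x≡ i j)))

tail² : ∀ {n} {A : Set} → (Fin (suc n) → Fin (suc n) → A) → Fin n → Fin n → A
tail² x i j = x (suc i) (suc j)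

dot₀ : ∀ {n} → Pt (suc n) → Pt (suc n) → ℚ
dot₀ π x = ∑ (λ j → π zero (suc j) * x zero (suc j) + π (suc j) zero * x (suc j) zero)

dot-suc : ∀ {n} (π x : Pt (suc n)) → dot π x ≡ dot₀ π x + dot (tail² π) (tail² x)
dot-suc {n} π x = begin
  (0ℚ + P) + ∑ (λ i → term (suc i) zero + ∑ (λ j → term (suc i) (suc j)))
    ≡⟨ cong₂ _+_ (ℚP.+-identityˡ P) (∑-distrib-+ (λ i → term (suc i) zero) (λ i → ∑ (λ j → term (suc i) (suc j)))) ⟩
  P + (Q + T)    ≡⟨ sym (ℚP.+-assoc P Q T) ⟩
  (P + Q) + T
    ≡⟨ cong₂ _+_ (sym (∑-distrib-+ (λ j → π zero (suc j) * x zero (suc j)) (λ i → π (suc i) zero * x (suc i) zero)))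
                 (∑-cong (λ i → ∑-cong (λ j → cong (λ e → if e then 0ℚ else tail² π i j * tail² x i j) (⌊suc⌋ i j)))) ⟩
  dot₀ π x + dot (tail² π) (tail² x) ∎
  where
  open ≡-Reasoning
  term : Fin (suc n) → Fin (suc n) → ℚ
  term i j = if ⌊ i ≟ j ⌋ then 0ℚ else π i j * x i j
  P = ∑ (λ j → π zero (suc j) * x zero (suc j))
  Q = ∑ (λ i → π (suc i) zero * x (suc i) zero)
  T = ∑ (λ i → ∑ (λ j → term (suc i) (suc j)))

-- Canonical labelling of Fin (2 + m): N̂ᶜ is the first m elements, i₂ = I₂ m = m and i₁ = I₁ m = m + 1.
I₁ I₂ : (m : ℕ) → Fin (2 ℕ.+ m)
I₁ zero    = suc zero
I₁ (suc m) = suc (I₁ m)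
I₂ zero    = zero
I₂ (suc m) = suc (I₂ m)

nc : ∀ {m} → Fin m → Fin (2 ℕ.+ m)
nc zero    = zero
nc (suc k) = suc (nc k)

I₁≢I₂ : ∀ m → I₁ m ≢ I₂ m
I₁≢I₂ zero    ()
I₁≢I₂ (suc m) e = I₁≢I₂ m (suc-injective e)

nc≢I₁ : ∀ {m} (k : Fin m) → nc k ≢ I₁ m
nc≢I₁ {suc m} zero    ()
nc≢I₁ {suc m} (suc k) e = nc≢I₁ k (suc-injective e)

nc≢I₂ : ∀ {m} (k : Fin m) → nc k ≢ I₂ m
nc≢I₂ {suc m} zero    ()
nc≢I₂ {suc m} (suc k) e = nc≢I₂ k (suc-injective e)

data Label (m : ℕ) : Fin (2 ℕ.+ m) → Set where
  isI₁ : Label m (I₁ m)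
  isI₂ : Label m (I₂ m)
  isNc : (k : Fin m) → Label m (nc k)

label : ∀ m (j : Fin (2 ℕ.+ m)) → Label m j
label zero    zero          = isI₂
label zero    (suc zero)    = isI₁
label (suc m) zero          = isNc zero
label (suc m) (suc j) with label m j
... | isI₁   = isI₁
... | isI₂   = isI₂
... | isNc k = isNc (suc k)

∑ᶜ : ∀ m → (Fin (2 ℕ.+ m) → ℚ) → ℚ
∑ᶜ m g = ∑ (λ k → g (nc k))

∑-labels : ∀ m (g : Fin (2 ℕ.+ m) → ℚ) → ∑ g ≡ ∑ᶜ m g + (g (I₂ m) + g (I₁ m))
∑-labels zero    g = trans (cong (g zero +_) (ℚP.+-identityʳ (g (suc zero)))) (sym (ℚP.+-identityˡ _))
∑-labels (suc m) g = trans (cong (g zero +_) (∑-labels m (λ j → g (suc j))))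
  (sym (ℚP.+-assoc (g zero) (∑ᶜ m (λ j → g (suc j))) (g (I₂ (suc m)) + g (I₁ (suc m)))))

πᶜ : ∀ m → Pt (2 ℕ.+ m)
πᶜ m = πthm (I₁ m) (I₂ m)

πᶜ-suc : ∀ m (i j : Fin (2 ℕ.+ m)) → πᶜ (suc m) (suc i) (suc j) ≡ πᶜ m i j
πᶜ-suc m = πthm-suc (I₁ m) (I₂ m)

module _ (m : ℕ) where

  private
    π₀ₛ : ∀ j → πᶜ (suc m) zero (suc j) ≡ πᵇ false false false ⌊ j ≟ I₁ m ⌋ ⌊ j ≟ I₂ m ⌋
    π₀ₛ j = cong₂ (πᵇ false false false) (⌊suc⌋ j (I₁ m)) (⌊suc⌋ j (I₂ m))

    πₛ₀ : ∀ j → πᶜ (suc m) (suc j) zero ≡ πᵇ false ⌊ j ≟ I₁ m ⌋ ⌊ j ≟ I₂ m ⌋ false false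
    πₛ₀ j = cong₂ (λ x y → πᵇ false x y false false) (⌊suc⌋ j (I₁ m)) (⌊suc⌋ j (I₂ m))

  π-0,I₁ : πᶜ (suc m) zero (suc (I₁ m)) ≡ 1ℚ
  π-0,I₁ = trans (π₀ₛ (I₁ m)) (cong₂ (πᵇ false false false) (⌊refl⌋ (I₁ m)) (⌊no⌋ (I₁≢I₂ m)))

  π-I₁,0 : πᶜ (suc m) (suc (I₁ m)) zero ≡ 1ℚ
  π-I₁,0 = trans (πₛ₀ (I₁ m)) (cong₂ (λ x y → πᵇ false x y false false) (⌊refl⌋ (I₁ m)) (⌊no⌋ (I₁≢I₂ m)))

  π-0,I₂ : πᶜ (suc m) zero (suc (I₂ m)) ≡ 0ℚ
  π-0,I₂ = trans (π₀ₛ (I₂ m)) (cong₂ (πᵇ false false false) (⌊no⌋ (I₁≢I₂ m ∘ sym)) (⌊refl⌋ (I₂ m)))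

  π-I₂,0 : πᶜ (suc m) (suc (I₂ m)) zero ≡ - 1ℚ
  π-I₂,0 = trans (πₛ₀ (I₂ m)) (cong₂ (λ x y → πᵇ false x y false false) (⌊no⌋ (I₁≢I₂ m ∘ sym)) (⌊refl⌋ (I₂ m)))

  π-0,nc : ∀ k → πᶜ (suc m) zero (suc (nc k)) ≡ - 1ℚ
  π-0,nc k = trans (π₀ₛ (nc k)) (cong₂ (πᵇ false false false) (⌊no⌋ (nc≢I₁ k)) (⌊no⌋ (nc≢I₂ k)))

  π-nc,0 : ∀ k → πᶜ (suc m) (suc (nc k)) zero ≡ - 1ℚ
  π-nc,0 k = trans (πₛ₀ (nc k)) (cong₂ (λ x y → πᵇ false x y false false) (⌊no⌋ (nc≢I₁ k)) (⌊no⌋ (nc≢I₂ k)))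

-- Validity

pref : ∀ {n} → WeakOrder n → Fin n → Fin n → ℚ
pref W i j = 𝟙 (R W i j)

tie : ∀ {n} → WeakOrder n → Fin n → Fin n → Bool
tie W i j = R W i j ∧ R W j i

pref-pair : ∀ {n} (W : WeakOrder n) i j → pref W i j + pref W j i ≡ 1ℚ + 𝟙 (tie W i j)
pref-pair W i j with R W i j | R W j i | WeakOrder.total W i j
... | true  | true  | _      = refl
... | true  | false | _      = refl
... | false | true  | _      = refl
... | false | false | inj₁ ()
... | false | false | inj₂ ()

∧-true : ∀ {x y} → x ∧ y ≡ true → x ≡ true × y ≡ true
∧-true {true} y≡true = refl , y≡true

tie-sym : ∀ {n} (W : WeakOrder n) {i j} → tie W i j ≡ true → tie W j i ≡ true
tie-sym W {i} {j} ij with ∧-true {R W i j} ij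
... | i≽j , j≽i rewrite i≽j | j≽i = refl

tie-trans : ∀ {n} (W : WeakOrder n) {i j k} → tie W i j ≡ true → tie W j k ≡ true → tie W i k ≡ true
tie-trans W {i} {j} {k} ij jk with ∧-true {R W i j} ij | ∧-true {R W j k} jk
... | i≽j , j≽i | j≽k , k≽j
  rewrite WeakOrder.trans W i j k i≽j j≽k | WeakOrder.trans W k j i k≽j j≽i = refl

pref-tie : ∀ {n} (W : WeakOrder n) i {j k} → tie W j k ≡ true → R W i j ≡ R W i k
pref-tie W i {j} {k} jk with ∧-true {R W j k} jk | R W i j in i≽j | R W i k in i≽k
... | _ , _       | true  | true  = refl
... | _ , _       | false | false = refl
... | j≽k , _     | true  | false = trans (sym (WeakOrder.trans W i j k i≽j j≽k)) i≽k
... | _ , k≽j     | false | true  = trans (sym i≽j) (WeakOrder.trans W i k j i≽k k≽j)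

restrict : ∀ {n} → WeakOrder (suc n) → WeakOrder n
restrict W = record
  { R     = tail² (R W)
  ; refl  = λ i → WeakOrder.refl W (suc i)
  ; trans = λ i j k → WeakOrder.trans W (suc i) (suc j) (suc k)
  ; total = λ i j → WeakOrder.total W (suc i) (suc j)
  }

χ-restrict : ∀ {n} (W : WeakOrder (suc n)) i j → χ W (suc i) (suc j) ≡ χ (restrict W) i j
χ-restrict W i j = cong (λ e → if e then 0ℚ else pref W (suc i) (suc j)) (⌊suc⌋ i j)

⟨_⟩ : ℕ → ℚ
⟨ m ⟩ = ∑ {m} (λ _ → 1ℚ)

-- The right-hand side for n = m + 2, by the recursion matching dot-step (see rhsthm≡rhsᶜ).
rhsᶜ : ℕ → ℚ
rhsᶜ zero    = 1ℚ
rhsᶜ (suc m) = rhsᶜ m + (1ℚ - ⟨ m ⟩)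

dotᶜ : ∀ m → WeakOrder (2 ℕ.+ m) → ℚ
dotᶜ m W = dot (πᶜ m) (χ W)

dotᶜ-zero : ∀ (W : WeakOrder 2) → dotᶜ 0 W ≡ pref W zero (suc zero)
dotᶜ-zero W = solve 2 (λ p q → (con 0ℚ :+ (con 1ℚ :* p :+ con 0ℚ)) :+ ((con 0ℚ :* q :+ (con 0ℚ :+ con 0ℚ)) :+ con 0ℚ) := p)
  refl (pref W zero (suc zero)) (pref W (suc zero) zero)

-- What the first element 0 of N̂ᶜ contributes to π x^W, apart from the constant 1 - m.
gain : ∀ m → WeakOrder (3 ℕ.+ m) → ℚ
gain m W = (𝟙 (tie W zero (suc (I₁ m))) - pref W (suc (I₂ m)) zero) - ∑ᶜ m (λ j → 𝟙 (tie W zero (suc j)))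

dot₀-formula : ∀ m (W : WeakOrder (3 ℕ.+ m)) → dot₀ (πᶜ (suc m)) (χ W) ≡ gain m W + (1ℚ - ⟨ m ⟩)
dot₀-formula m W = begin
  dot₀ (πᶜ (suc m)) (χ W)                        ≡⟨ ∑-labels m h ⟩
  ∑ᶜ m h + (h (I₂ m) + h (I₁ m))
    ≡⟨ cong₂ _+_ (trans (∑-cong h-nc) (∑-neg (λ k → pref W zero (suc (nc k)) + pref W (suc (nc k)) zero)))
                 (cong₂ _+_ h-I₂ (trans h-I₁ (pref-pair W zero (suc (I₁ m))))) ⟩
  - ∑ᶜ m (λ j → pref W zero (suc j) + pref W (suc j) zero) + (- r + (1ℚ + t))
    ≡⟨ cong (λ x → - x + (- r + (1ℚ + t))) (trans (∑-cong (λ k → pref-pair W zero (suc (nc k))))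
                                                     (∑-distrib-+ (λ _ → 1ℚ) (λ k → 𝟙 (tie W zero (suc (nc k)))))) ⟩
  - (⟨ m ⟩ + S) + (- r + (1ℚ + t))
    ≡⟨ solve 4 (λ M S r t → (:- (M :+ S)) :+ ((:- r) :+ (con 1ℚ :+ t)) := ((t :- r) :- S) :+ (con 1ℚ :- M))
               refl ⟨ m ⟩ S r t ⟩
  gain m W + (1ℚ - ⟨ m ⟩)                        ∎
  where
  open ≡-Reasoning
  h : Fin (2 ℕ.+ m) → ℚ
  h j = πᶜ (suc m) zero (suc j) * χ W zero (suc j) + πᶜ (suc m) (suc j) zero * χ W (suc j) zero
  r = pref W (suc (I₂ m)) zero
  t = 𝟙 (tie W zero (suc (I₁ m)))
  S = ∑ᶜ m (λ j → 𝟙 (tie W zero (suc j)))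
  h-I₁ : h (I₁ m) ≡ pref W zero (suc (I₁ m)) + pref W (suc (I₁ m)) zero
  h-I₁ rewrite π-0,I₁ m | π-I₁,0 m = cong₂ _+_ (ℚP.*-identityˡ (pref W zero (suc (I₁ m)))) (ℚP.*-identityˡ (pref W (suc (I₁ m)) zero))
  h-I₂ : h (I₂ m) ≡ - r
  h-I₂ rewrite π-0,I₂ m | π-I₂,0 m = solve 2 (λ x y → con 0ℚ :* x :+ (:- con 1ℚ) :* y := :- y) refl (pref W zero (suc (I₂ m))) r
  h-nc : ∀ k → h (nc k) ≡ - (pref W zero (suc (nc k)) + pref W (suc (nc k)) zero)
  h-nc k rewrite π-0,nc m k | π-nc,0 m k =
    solve 2 (λ x y → (:- con 1ℚ) :* x :+ (:- con 1ℚ) :* y := :- (x :+ y)) refl (pref W zero (suc (nc k))) (pref W (suc (nc k)) zero)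

dot-step : ∀ m (W : WeakOrder (3 ℕ.+ m)) → dotᶜ (suc m) W ≡ (dotᶜ m (restrict W) + gain m W) + (1ℚ - ⟨ m ⟩)
dot-step m W = begin
  dotᶜ (suc m) W                                            ≡⟨ dot-suc (πᶜ (suc m)) (χ W) ⟩
  dot₀ (πᶜ (suc m)) (χ W) + dot (tail² (πᶜ (suc m))) (tail² (χ W))
    ≡⟨ cong₂ _+_ (dot₀-formula m W) (dot-cong (πᶜ-suc m) (χ-restrict W)) ⟩
  (gain m W + (1ℚ - ⟨ m ⟩)) + dotᶜ m (restrict W)
    ≡⟨ solve 3 (λ g c d → (g :+ c) :+ d := (d :+ g) :+ c) refl (gain m W) (1ℚ - ⟨ m ⟩) (dotᶜ m (restrict W)) ⟩
  (dotᶜ m (restrict W) + gain m W) + (1ℚ - ⟨ m ⟩)           ∎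
  where open ≡-Reasoning

NoTieWithI₁ : ∀ m → WeakOrder (2 ℕ.+ m) → Set
NoTieWithI₁ m W = ∀ k → tie W (nc k) (I₁ m) ≡ false

valid : ∀ m (W : WeakOrder (2 ℕ.+ m)) →
  dotᶜ m W ≤ rhsᶜ m × (NoTieWithI₁ m W → dotᶜ m W ≤ (rhsᶜ m - 1ℚ) + pref W (I₂ m) (I₁ m))
valid zero W =
  ℚP.≤-trans (ℚP.≤-reflexive (dotᶜ-zero W)) (𝟙≤1 (R W zero (suc zero))) ,
  λ _ → ℚP.≤-reflexive (trans (dotᶜ-zero W) (solve 1 (λ p → p := (con 1ℚ :- con 1ℚ) :+ p) refl (pref W zero (suc zero))))
valid (suc m) W = lift core , boundNoTie
  where
  open ℚP.≤-Reasoning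
  W′ = restrict W
  IH = valid m W′
  d′ = dotᶜ m W′
  r = pref W (suc (I₂ m)) zero
  S = ∑ᶜ m (λ j → 𝟙 (tie W zero (suc j)))
  r≥0 = 𝟙-nonNeg (R W (suc (I₂ m)) zero)
  S≥0 = ∑-nonNeg (λ k → 𝟙 (tie W zero (suc (nc k)))) (λ k → 𝟙-nonNeg _)

  lift : ∀ {X} → d′ + gain m W ≤ X → dotᶜ (suc m) W ≤ X + (1ℚ - ⟨ m ⟩)
  lift h = ℚP.≤-trans (ℚP.≤-reflexive (dot-step m W)) (ℚP.+-monoˡ-≤ (1ℚ - ⟨ m ⟩) h)

  drop : ∀ {g} → g ≤ 0ℚ → d′ + g ≤ d′
  drop {g} g≤0 = ℚP.≤-trans (ℚP.+-monoʳ-≤ d′ g≤0) (ℚP.≤-reflexive (ℚP.+-identityʳ d′))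

  untied : tie W zero (suc (I₁ m)) ≡ false → gain m W ≤ 0ℚ
  untied t rewrite t = begin
    (0ℚ - r) - S   ≡⟨ solve 2 (λ r S → (con 0ℚ :- r) :- S := :- (r :+ S)) refl r S ⟩
    - (r + S)      ≤⟨ ℚP.neg-antimono-≤ (ℚP.+-mono-≤ r≥0 S≥0) ⟩
    0ℚ             ∎

  tied : tie W zero (suc (I₁ m)) ≡ true → gain m W ≡ (1ℚ - r) - S
  tied t = cong (λ b → (𝟙 b - r) - S) t

  -- If 0 ∼ i₁ and some element of N̂ᶜ is tied with i₁, it is also tied with 0, so S ≥ 1; otherwise the
  -- sharper bound for W′ applies, where x_{i₂ i₁} = x_{i₂ 0} since 0 ∼ i₁.
  core : d′ + gain m W ≤ rhsᶜ m
  core = by-tie (tie W zero (suc (I₁ m))) refl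
    where
    by-tie : ∀ b → tie W zero (suc (I₁ m)) ≡ b → d′ + gain m W ≤ rhsᶜ m
    by-tie false t = ℚP.≤-trans (drop (untied t)) (proj₁ IH)
    by-tie true  t with any? (λ k → tie W′ (nc k) (I₁ m) 𝔹.≟ true)
    ... | yes (k , k~I₁) = ℚP.≤-trans (drop gain≤0) (proj₁ IH)
      where
      S≥1 : 1ℚ ≤ S
      S≥1 = ℚP.≤-trans (ℚP.≤-reflexive (cong 𝟙 (sym (tie-trans W t (tie-sym W k~I₁)))))
                       (term≤∑ (λ k → 𝟙 (tie W zero (suc (nc k)))) (λ k → 𝟙-nonNeg _) k)
      gain≤0 : gain m W ≤ 0ℚ
      gain≤0 = begin
        gain m W         ≡⟨ tied t ⟩
        (1ℚ - r) - S     ≡⟨ solve 2 (λ r S → (con 1ℚ :- r) :- S := :- ((S :- con 1ℚ) :+ r)) refl r S ⟩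
        - ((S - 1ℚ) + r) ≤⟨ ℚP.neg-antimono-≤ (ℚP.+-mono-≤ (ℚP.+-monoˡ-≤ (- 1ℚ) S≥1) r≥0) ⟩
        0ℚ               ∎
    ... | no ¬tie = begin
      d′ + gain m W                            ≤⟨ ℚP.+-monoˡ-≤ (gain m W) (proj₂ IH (λ k → 𝔹P.¬-not (λ e → ¬tie (k , e)))) ⟩
      ((rhsᶜ m - 1ℚ) + pref W′ (I₂ m) (I₁ m)) + gain m W
        ≡⟨ cong₂ (λ b g → ((rhsᶜ m - 1ℚ) + 𝟙 b) + g) (pref-tie W (suc (I₂ m)) (tie-sym W t)) (tied t) ⟩
      ((rhsᶜ m - 1ℚ) + r) + ((1ℚ - r) - S)     ≡⟨ solve 3 (λ q r S → ((q :- con 1ℚ) :+ r) :+ ((con 1ℚ :- r) :- S) := q :+ (:- S)) refl (rhsᶜ m) r S ⟩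
      rhsᶜ m - S                               ≤⟨ ℚP.+-monoʳ-≤ (rhsᶜ m) (ℚP.neg-antimono-≤ S≥0) ⟩
      rhsᶜ m + - 0ℚ                            ≡⟨ ℚP.+-identityʳ (rhsᶜ m) ⟩
      rhsᶜ m                                   ∎

  boundNoTie : NoTieWithI₁ (suc m) W → dotᶜ (suc m) W ≤ (rhsᶜ (suc m) - 1ℚ) + pref W (I₂ (suc m)) (I₁ (suc m))
  boundNoTie noTie = ℚP.≤-trans (lift (ℚP.≤-trans (drop (untied (noTie zero))) (proj₂ IH (noTie ∘ suc))))
    (ℚP.≤-reflexive (solve 3 (λ q M p → ((q :- con 1ℚ) :+ p) :+ (con 1ℚ :- M) := ((q :+ (con 1ℚ :- M)) :- con 1ℚ) :+ p)
                           refl (rhsᶜ m) ⟨ m ⟩ (pref W′ (I₂ m) (I₁ m))))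

-- Homogenised arc coordinates

-- The n(n-1) arcs of Fin n; those of Fin (suc n) are the (0, j+1), then the (j+1, 0), then the
-- shifted arcs of Fin n.
arcs : ℕ → ℕ
arcs zero    = zero
arcs (suc n) = (n ℕ.+ n) ℕ.+ arcs n

arc₀ : ∀ {n} → Fin (n ℕ.+ n) → Fin (suc n) × Fin (suc n)
arc₀ {n} s = [ (λ j → zero , suc j) , (λ j → suc j , zero) ]′ (splitAt n s)

arc : ∀ {n} → Fin (arcs n) → Fin n × Fin n
arc {suc n} t = [ arc₀ , (λ t′ → suc (proj₁ (arc t′)) , suc (proj₂ (arc t′))) ]′ (splitAt (n ℕ.+ n) t)

arc-surjective : ∀ {n} (i j : Fin n) → i ≢ j → Σ (Fin (arcs n)) λ t → arc t ≡ (i , j)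
arc-surjective {suc n} zero    zero    i≢j = ⊥-elim (i≢j refl)
arc-surjective {suc n} zero    (suc j) _   = (j ↑ˡ n) ↑ˡ arcs n ,
  trans (cong [ arc₀ , _ ]′ (splitAt-↑ˡ (n ℕ.+ n) (j ↑ˡ n) (arcs n)))
        (cong [ (λ j → zero , suc j) , (λ j → suc j , zero) ]′ (splitAt-↑ˡ n j n))
arc-surjective {suc n} (suc i) zero    _   = (n ↑ʳ i) ↑ˡ arcs n ,
  trans (cong [ arc₀ , _ ]′ (splitAt-↑ˡ (n ℕ.+ n) (n ↑ʳ i) (arcs n)))
        (cong [ (λ j → zero , suc j) , (λ j → suc j , zero) ]′ (splitAt-↑ʳ n n i))
arc-surjective {suc n} (suc i) (suc j) i≢j with arc-surjective i j (i≢j ∘ cong suc)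
... | t′ , arc≡ = (n ℕ.+ n) ↑ʳ t′ ,
  trans (cong [ arc₀ , (λ t′ → suc (proj₁ (arc t′)) , suc (proj₂ (arc t′))) ]′ (splitAt-↑ʳ (n ℕ.+ n) (arcs n) t′))
        (cong (λ p → suc (proj₁ p) , suc (proj₂ p)) arc≡)

-- Coordinate 0 is the homogenising coordinate, so affine independence of points is linear independence
-- of their homogenisations.
homog : ∀ {n} → Pt n → Fin (suc (arcs n)) → ℚ
homog x zero    = 1ℚ
homog x (suc t) = x (proj₁ (arc t)) (proj₂ (arc t))

-- The homogenisation of x^W for W with a new element 0 put strictly on top is raise (homog x^W),
-- and onNewArcs f g is the vector supported on the new arcs, with f on the (0, j+1) and g on the (j+1, 0).
raise : ∀ {n} → (Fin (suc (arcs n)) → ℚ) → Fin (suc (arcs (suc n))) → ℚ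
raise v zero    = v zero
raise {n} v (suc t) =
  [ (λ s → [ (λ _ → v zero) , (λ _ → 0ℚ) ]′ (splitAt n s)) , (λ t′ → v (suc t′)) ]′ (splitAt (n ℕ.+ n) t)

onNewArcs : ∀ {n} (f g : Fin n → ℚ) → Fin (suc (arcs (suc n))) → ℚ
onNewArcs f g zero    = 0ℚ
onNewArcs {n} f g (suc t) = [ (λ s → [ f , g ]′ (splitAt n s)) , (λ _ → 0ℚ) ]′ (splitAt (n ℕ.+ n) t)

-- x^W on the new arcs, shifted by -1 on the (0, j+1) where the top element of raise has a 1.
outArc inArc : ∀ {n} → WeakOrder (suc n) → Fin n → ℚ
outArc W j = pref W zero (suc j) - 1ℚ
inArc  W j = pref W (suc j) zero

homog-split : ∀ {n} (W : WeakOrder (suc n)) t →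
  homog (χ W) t ≡ raise {n} (homog (χ (restrict W))) t + onNewArcs (outArc W) (inArc W) t
homog-split W zero = sym (ℚP.+-identityʳ 1ℚ)
homog-split {n} W (suc t) with splitAt (n ℕ.+ n) t
... | inj₂ t′ = trans (χ-restrict W (proj₁ (arc t′)) (proj₂ (arc t′))) (sym (ℚP.+-identityʳ _))
... | inj₁ s with splitAt n s
...   | inj₁ j = solve 1 (λ x → x := con 1ℚ :+ (x :- con 1ℚ)) refl (pref W zero (suc j))
...   | inj₂ j = sym (ℚP.+-identityˡ _)

raise-linear : ∀ {n} → IsLinear (raise {n})
raise-linear {n} = record { cong-pointwise = cong-pw ; map-zero = map-zero ; map-lin = map-lin }
  where
  cong-pw : ∀ {v w} → (∀ t → v t ≡ w t) → ∀ t → raise {n} v t ≡ raise {n} w t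
  cong-pw v≡w zero = v≡w zero
  cong-pw v≡w (suc t) with splitAt (n ℕ.+ n) t
  ... | inj₂ t′ = v≡w (suc t′)
  ... | inj₁ s with splitAt n s
  ...   | inj₁ j = v≡w zero
  ...   | inj₂ j = refl
  map-zero : ∀ t → raise {n} (λ _ → 0ℚ) t ≡ 0ℚ
  map-zero zero = refl
  map-zero (suc t) with splitAt (n ℕ.+ n) t
  ... | inj₂ t′ = refl
  ... | inj₁ s with splitAt n s
  ...   | inj₁ j = refl
  ...   | inj₂ j = refl
  map-lin : ∀ c v w t → raise {n} (λ s → c * v s + w s) t ≡ c * raise {n} v t + raise {n} w t
  map-lin c v w zero = refl
  map-lin c v w (suc t) with splitAt (n ℕ.+ n) t
  ... | inj₂ t′ = refl
  ... | inj₁ s with splitAt n s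
  ...   | inj₁ j = refl
  ...   | inj₂ j = solve 1 (λ c → con 0ℚ := c :* con 0ℚ :+ con 0ℚ) refl c

module _ {n : ℕ} where

  onNewArcs-cong : ∀ {f f′ g g′ : Fin n → ℚ} → (∀ j → f j ≡ f′ j) → (∀ j → g j ≡ g′ j) →
    ∀ t → onNewArcs f g t ≡ onNewArcs f′ g′ t
  onNewArcs-cong f≡ g≡ zero = refl
  onNewArcs-cong f≡ g≡ (suc t) with splitAt (n ℕ.+ n) t
  ... | inj₂ t′ = refl
  ... | inj₁ s with splitAt n s
  ...   | inj₁ j = f≡ j
  ...   | inj₂ j = g≡ j

  onNewArcs-lin : ∀ c (f₁ g₁ f₂ g₂ : Fin n → ℚ) t →
    onNewArcs (λ j → c * f₁ j + f₂ j) (λ j → c * g₁ j + g₂ j) t ≡ c * onNewArcs f₁ g₁ t + onNewArcs f₂ g₂ t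
  onNewArcs-lin c f₁ g₁ f₂ g₂ zero = solve 1 (λ c → con 0ℚ := c :* con 0ℚ :+ con 0ℚ) refl c
  onNewArcs-lin c f₁ g₁ f₂ g₂ (suc t) with splitAt (n ℕ.+ n) t
  ... | inj₂ t′ = solve 1 (λ c → con 0ℚ := c :* con 0ℚ :+ con 0ℚ) refl c
  ... | inj₁ s with splitAt n s
  ...   | inj₁ j = refl
  ...   | inj₂ j = refl

  onNewArcs-zero : ∀ t → onNewArcs {n} (λ _ → 0ℚ) (λ _ → 0ℚ) t ≡ 0ℚ
  onNewArcs-zero zero = refl
  onNewArcs-zero (suc t) with splitAt (n ℕ.+ n) t
  ... | inj₂ t′ = refl
  ... | inj₁ s with splitAt n s
  ...   | inj₁ j = refl
  ...   | inj₂ j = refl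

  onNewArcs-basis : ∀ (f g : Fin n → ℚ) t →
    onNewArcs f g t ≡ ∑ (λ j → f j * onNewArcs (basis j) (λ _ → 0ℚ) t) + ∑ (λ j → g j * onNewArcs (λ _ → 0ℚ) (basis j) t)
  onNewArcs-basis f g zero = sym (cong₂ _+_ (∑-zero (λ j → ℚP.*-zeroʳ (f j))) (∑-zero (λ j → ℚP.*-zeroʳ (g j))))
  onNewArcs-basis f g (suc t) with splitAt (n ℕ.+ n) t
  ... | inj₂ t′ = sym (cong₂ _+_ (∑-zero (λ j → ℚP.*-zeroʳ (f j))) (∑-zero (λ j → ℚP.*-zeroʳ (g j))))
  ... | inj₁ s with splitAt n s
  ...   | inj₁ j₀ = sym (trans (cong₂ _+_ (∑-basisʳ f j₀) (∑-zero (λ j → ℚP.*-zeroʳ (g j)))) (ℚP.+-identityʳ (f j₀)))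
  ...   | inj₂ j₀ = sym (trans (cong₂ _+_ (∑-zero (λ j → ℚP.*-zeroʳ (f j))) (∑-basisʳ g j₀)) (ℚP.+-identityˡ (g j₀)))

-- Weak orders on the face

_≼_ : ℕ → ℕ → Bool
zero  ≼ _     = true
suc _ ≼ zero  = false
suc x ≼ suc y = x ≼ y

≼-refl : ∀ x → (x ≼ x) ≡ true
≼-refl zero    = refl
≼-refl (suc x) = ≼-refl x

≼-trans : ∀ x y z → (x ≼ y) ≡ true → (y ≼ z) ≡ true → (x ≼ z) ≡ true
≼-trans zero    y       z       _   _   = refl
≼-trans (suc x) (suc y) (suc z) x≼y y≼z = ≼-trans x y z x≼y y≼z

≼-total : ∀ x y → (x ≼ y) ≡ true ⊎ (y ≼ x) ≡ true
≼-total zero    y       = inj₁ refl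
≼-total (suc x) zero    = inj₂ refl
≼-total (suc x) (suc y) = ≼-total x y

≤⇒≼ : ∀ {x y} → x ℕ.≤ y → (x ≼ y) ≡ true
≤⇒≼ {zero}          _         = refl
≤⇒≼ {suc x} {suc y} (s≤s x≤y) = ≤⇒≼ x≤y

<⇒⋠ : ∀ {x y} → y ℕ.< x → (x ≼ y) ≡ false
<⇒⋠ {suc x} {zero}  _         = refl
<⇒⋠ {suc x} {suc y} (s≤s y<x) = <⇒⋠ y<x

byRank : ∀ {n} → (Fin n → ℕ) → WeakOrder n
byRank rk = record
  { R     = λ i j → rk i ≼ rk j
  ; refl  = λ i → ≼-refl (rk i)
  ; trans = λ i j k → ≼-trans (rk i) (rk j) (rk k)
  ; total = λ i j → ≼-total (rk i) (rk j)
  }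

false≢true : false ≢ true
false≢true ()

onTop : ∀ {n} → WeakOrder n → WeakOrder (suc n)
onTop {n} W = record { R = R′ ; refl = refl′ ; trans = trans′ ; total = total′ }
  where
  R′ : Fin (suc n) → Fin (suc n) → Bool
  R′ zero    _       = true
  R′ (suc i) zero    = false
  R′ (suc i) (suc j) = R W i j
  refl′ : ∀ i → R′ i i ≡ true
  refl′ zero    = refl
  refl′ (suc i) = WeakOrder.refl W i
  trans′ : ∀ i j k → R′ i j ≡ true → R′ j k ≡ true → R′ i k ≡ true
  trans′ zero    j       k       _ _ = refl
  trans′ (suc i) zero    k       () _
  trans′ (suc i) (suc j) zero    _ ()
  trans′ (suc i) (suc j) (suc k) ij jk = WeakOrder.trans W i j k ij jk
  total′ : ∀ i j → R′ i j ≡ true ⊎ R′ j i ≡ true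
  total′ zero    j       = inj₁ refl
  total′ (suc i) zero    = inj₂ refl
  total′ (suc i) (suc j) = WeakOrder.total W i j

tiedWith : ∀ {n} → WeakOrder n → Fin n → WeakOrder (suc n)
tiedWith {n} W s = record { R = R′ ; refl = refl′ ; trans = trans′ ; total = total′ }
  where
  R′ : Fin (suc n) → Fin (suc n) → Bool
  R′ zero    zero    = true
  R′ zero    (suc j) = R W s j
  R′ (suc i) zero    = R W i s
  R′ (suc i) (suc j) = R W i j
  refl′ : ∀ i → R′ i i ≡ true
  refl′ zero    = refl
  refl′ (suc i) = WeakOrder.refl W i
  trans′ : ∀ i j k → R′ i j ≡ true → R′ j k ≡ true → R′ i k ≡ true
  trans′ zero    zero    k       _  jk = jk
  trans′ zero    (suc j) zero    _  _  = refl
  trans′ zero    (suc j) (suc k) ij jk = WeakOrder.trans W s j k ij jk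
  trans′ (suc i) zero    zero    ij _  = ij
  trans′ (suc i) zero    (suc k) ij jk = WeakOrder.trans W i s k ij jk
  trans′ (suc i) (suc j) zero    ij jk = WeakOrder.trans W i j s ij jk
  trans′ (suc i) (suc j) (suc k) ij jk = WeakOrder.trans W i j k ij jk
  total′ : ∀ i j → R′ i j ≡ true ⊎ R′ j i ≡ true
  total′ zero    zero    = inj₁ refl
  total′ zero    (suc j) = WeakOrder.total W s j
  total′ (suc i) zero    = WeakOrder.total W i s
  total′ (suc i) (suc j) = WeakOrder.total W i j

justBelow : ∀ {n} → WeakOrder n → Fin n → WeakOrder (suc n)
justBelow {n} W s = record { R = R′ ; refl = refl′ ; trans = trans′ ; total = total′ }
  where
  R′ : Fin (suc n) → Fin (suc n) → Bool
  R′ zero    zero    = true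
  R′ zero    (suc j) = not (R W j s)
  R′ (suc i) zero    = R W i s
  R′ (suc i) (suc j) = R W i j
  refl′ : ∀ i → R′ i i ≡ true
  refl′ zero    = refl
  refl′ (suc i) = WeakOrder.refl W i
  trans′ : ∀ i j k → R′ i j ≡ true → R′ j k ≡ true → R′ i k ≡ true
  trans′ zero    zero    k       _  jk = jk
  trans′ zero    (suc j) zero    _  _  = refl
  trans′ zero    (suc j) (suc k) ij jk with R W k s in k≽s
  ... | false = refl
  ... | true  = ⊥-elim (false≢true (trans (sym (𝔹P.not-injective ij)) (WeakOrder.trans W j k s jk k≽s)))
  trans′ (suc i) zero    zero    ij _  = ij
  trans′ (suc i) zero    (suc k) ij jk with WeakOrder.total W i k
  ... | inj₁ i≽k = i≽k
  ... | inj₂ k≽i = ⊥-elim (false≢true (trans (sym (𝔹P.not-injective jk)) (WeakOrder.trans W k i s k≽i ij)))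
  trans′ (suc i) (suc j) zero    ij jk = WeakOrder.trans W i j s ij jk
  trans′ (suc i) (suc j) (suc k) ij jk = WeakOrder.trans W i j k ij jk
  total′ : ∀ i j → R′ i j ≡ true ⊎ R′ j i ≡ true
  total′ zero    zero    = inj₁ refl
  total′ zero    (suc j) with R W j s
  ... | true  = inj₂ refl
  ... | false = inj₁ refl
  total′ (suc i) zero    with R W i s
  ... | true  = inj₁ refl
  ... | false = inj₂ refl
  total′ (suc i) (suc j) = WeakOrder.total W i j

IsFace : ∀ m → WeakOrder (2 ℕ.+ m) → Set
IsFace m W = dotᶜ m W ≡ rhsᶜ m

gain≡0⇒face : ∀ m (W : WeakOrder (3 ℕ.+ m)) → gain m W ≡ 0ℚ → IsFace m (restrict W) → IsFace (suc m) W
gain≡0⇒face m W gain≡0 face =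
  trans (dot-step m W) (cong (_+ (1ℚ - ⟨ m ⟩)) (trans (cong₂ _+_ face gain≡0) (ℚP.+-identityʳ (rhsᶜ m))))

gain-onTop : ∀ m (W : WeakOrder (2 ℕ.+ m)) → gain m (onTop W) ≡ 0ℚ
gain-onTop m W = cong (λ S → (0ℚ - 0ℚ) - S) (∑-zero {m} (λ _ → refl))

onTop-face : ∀ m W → IsFace m W → IsFace (suc m) (onTop W)
onTop-face m W = gain≡0⇒face m (onTop W) (gain-onTop m W)

onTop-nonface : ∀ m W → dotᶜ m W ≢ rhsᶜ m → dotᶜ (suc m) (onTop W) ≢ rhsᶜ (suc m)
onTop-nonface m W nonface e = nonface (+-cancelʳ (1ℚ - ⟨ m ⟩) (dotᶜ m W) (rhsᶜ m) (begin
  dotᶜ m W + (1ℚ - ⟨ m ⟩)                       ≡⟨ cong (_+ (1ℚ - ⟨ m ⟩)) (sym (trans (cong (dotᶜ m W +_) (gain-onTop m W)) (ℚP.+-identityʳ (dotᶜ m W)))) ⟩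
  (dotᶜ m W + gain m (onTop W)) + (1ℚ - ⟨ m ⟩)  ≡⟨ sym (dot-step m (onTop W)) ⟩
  dotᶜ (suc m) (onTop W)                        ≡⟨ e ⟩
  rhsᶜ m + (1ℚ - ⟨ m ⟩)                         ∎))
  where open ≡-Reasoning

justBelow-face : ∀ m W s → R W (I₂ m) s ≡ false → IsFace m W → IsFace (suc m) (justBelow W s)
justBelow-face m W s I₂⋡s = gain≡0⇒face m (justBelow W s) (begin
  (𝟙 (not (R W (I₁ m) s) ∧ R W (I₁ m) s) - 𝟙 (R W (I₂ m) s)) - ∑ᶜ m (λ j → 𝟙 (not (R W j s) ∧ R W j s))
    ≡⟨ cong₂ (λ x y → (𝟙 x - 𝟙 y) - ∑ᶜ m (λ j → 𝟙 (not (R W j s) ∧ R W j s))) (𝔹P.∧-inverseˡ (R W (I₁ m) s)) I₂⋡s ⟩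
  (0ℚ - 0ℚ) - ∑ᶜ m (λ j → 𝟙 (not (R W j s) ∧ R W j s))
    ≡⟨ cong (λ S → (0ℚ - 0ℚ) - S) (∑-zero (λ k → cong 𝟙 (𝔹P.∧-inverseˡ (R W (nc k) s)))) ⟩
  0ℚ ∎)
  where open ≡-Reasoning

tiedWithI₁-face : ∀ m W →
  pref W (I₂ m) (I₁ m) ≡ (1ℚ - ∑ᶜ m (λ j → 𝟙 (tie W (I₁ m) j))) + (dotᶜ m W - rhsᶜ m) →
  IsFace (suc m) (tiedWith W (I₁ m))
tiedWithI₁-face m W defect = begin
  dotᶜ (suc m) (tiedWith W (I₁ m))                             ≡⟨ dot-step m (tiedWith W (I₁ m)) ⟩
  (dotᶜ m W + ((𝟙 (R W (I₁ m) (I₁ m) ∧ R W (I₁ m) (I₁ m)) - pref W (I₂ m) (I₁ m)) - S)) + (1ℚ - ⟨ m ⟩)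
    ≡⟨ cong₂ (λ b r → (dotᶜ m W + ((𝟙 (b ∧ b) - r) - S)) + (1ℚ - ⟨ m ⟩)) (WeakOrder.refl W (I₁ m)) defect ⟩
  (dotᶜ m W + ((1ℚ - ((1ℚ - S) + (dotᶜ m W - rhsᶜ m))) - S)) + (1ℚ - ⟨ m ⟩)
    ≡⟨ cong (_+ (1ℚ - ⟨ m ⟩)) (solve 3 (λ d S q → d :+ ((con 1ℚ :- ((con 1ℚ :- S) :+ (d :- q))) :- S) := q) refl (dotᶜ m W) S (rhsᶜ m)) ⟩
  rhsᶜ (suc m)                                                 ∎
  where
  open ≡-Reasoning
  S = ∑ᶜ m (λ j → 𝟙 (tie W (I₁ m) j))

rank : ∀ m → ℕ → ℕ → ℕ → Fin (2 ℕ.+ m) → ℕ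
rank zero    a b off zero       = b
rank zero    a b off (suc zero) = a
rank (suc m) a b off zero       = off
rank (suc m) a b off (suc j)    = rank m a b (suc off) j

rank-I₁ : ∀ m a b off → rank m a b off (I₁ m) ≡ a
rank-I₁ zero    a b off = refl
rank-I₁ (suc m) a b off = rank-I₁ m a b (suc off)

rank-I₂ : ∀ m a b off → rank m a b off (I₂ m) ≡ b
rank-I₂ zero    a b off = refl
rank-I₂ (suc m) a b off = rank-I₂ m a b (suc off)

rank-nc : ∀ m a b off (k : Fin m) → rank m a b off (nc k) ≡ toℕ k ℕ.+ off
rank-nc (suc m) a b off zero    = refl
rank-nc (suc m) a b off (suc k) = trans (rank-nc m a b (suc off) k) (ℕP.+-suc (toℕ k) off)

rank-nc₀ : ∀ m a b (k : Fin m) → rank m a b 0 (nc k) ≡ toℕ k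
rank-nc₀ m a b k = trans (rank-nc m a b 0 k) (ℕP.+-identityʳ (toℕ k))

ranked : ∀ m → ℕ → ℕ → ℕ → WeakOrder (2 ℕ.+ m)
ranked m a b off = byRank (rank m a b off)

-- Whether rank a is taken by an element of N̂ᶜ.
taken : ℕ → ℕ → ℕ → Bool
taken a off m = (off ≼ a) ∧ not ((off ℕ.+ m) ≼ a)

taken-zero : ∀ a off → taken a off 0 ≡ false
taken-zero a off = trans (cong (λ z → (off ≼ a) ∧ not (z ≼ a)) (ℕP.+-identityʳ off)) (𝔹P.∧-inverseʳ (off ≼ a))

taken-suc : ∀ off a K → off ℕ.≤ K →
  𝟙 ((off ≼ a) ∧ (a ≼ off)) + 𝟙 ((suc off ≼ a) ∧ not (suc K ≼ a)) ≡ 𝟙 ((off ≼ a) ∧ not (suc K ≼ a))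
taken-suc zero    zero    K       _         = refl
taken-suc zero    (suc a) K       _         = ℚP.+-identityˡ _
taken-suc (suc o) zero    K       _         = refl
taken-suc (suc o) (suc a) (suc K) (s≤s o≤K) = taken-suc o a K o≤K

dotᶜ-ranked : ∀ m a b off → off ℕ.+ m ℕ.≤ b →
  dotᶜ m (ranked m a b off) ≡ ((rhsᶜ m - 1ℚ) + 𝟙 (b ≼ a)) + 𝟙 (taken a off m)
dotᶜ-ranked zero a b off _ = begin
  dotᶜ 0 (ranked 0 a b off)                    ≡⟨ dotᶜ-zero (ranked 0 a b off) ⟩
  𝟙 (b ≼ a)                                    ≡⟨ solve 1 (λ x → x := ((con 1ℚ :- con 1ℚ) :+ x) :+ con 0ℚ) refl (𝟙 (b ≼ a)) ⟩
  ((1ℚ - 1ℚ) + 𝟙 (b ≼ a)) + 0ℚ                 ≡⟨ cong (λ z → ((1ℚ - 1ℚ) + 𝟙 (b ≼ a)) + 𝟙 z) (taken-zero a off) ⟨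
  ((1ℚ - 1ℚ) + 𝟙 (b ≼ a)) + 𝟙 (taken a off 0)  ∎
  where open ≡-Reasoning
dotᶜ-ranked (suc m) a b off off+m≤b = begin
  dotᶜ (suc m) W                                       ≡⟨ dot-step m W ⟩
  (dotᶜ m W′ + ((t - r) - S)) + (1ℚ - ⟨ m ⟩)
    ≡⟨ cong₂ (λ d x → (d + x) + (1ℚ - ⟨ m ⟩)) (dotᶜ-ranked m a b (suc off) off+1+m≤b) (cong₂ (λ r S → (t - r) - S) r≡0 S≡0) ⟩
  ((((rhsᶜ m - 1ℚ) + B) + T) + ((t - 0ℚ) - 0ℚ)) + (1ℚ - ⟨ m ⟩)
    ≡⟨ solve 5 (λ q B T t M → ((((q :- con 1ℚ) :+ B) :+ T) :+ ((t :- con 0ℚ) :- con 0ℚ)) :+ (con 1ℚ :- M)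
                              := (((q :+ (con 1ℚ :- M)) :- con 1ℚ) :+ B) :+ (t :+ T)) refl (rhsᶜ m) B T t ⟨ m ⟩ ⟩
  ((rhsᶜ (suc m) - 1ℚ) + B) + (t + T)                 ≡⟨ cong (((rhsᶜ (suc m) - 1ℚ) + B) +_) t+T ⟩
  ((rhsᶜ (suc m) - 1ℚ) + B) + 𝟙 (taken a off (suc m)) ∎
  where
  open ≡-Reasoning
  W = ranked (suc m) a b off
  W′ = restrict W
  t = 𝟙 (tie W zero (suc (I₁ m)))
  r = pref W (suc (I₂ m)) zero
  S = ∑ᶜ m (λ j → 𝟙 (tie W zero (suc j)))
  B = 𝟙 (b ≼ a)
  T = 𝟙 (taken a (suc off) m)
  off+1+m≤b : suc off ℕ.+ m ℕ.≤ b
  off+1+m≤b = subst (ℕ._≤ b) (ℕP.+-suc off m) off+m≤b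
  r≡0 : r ≡ 0ℚ
  r≡0 = cong 𝟙 (trans (cong (_≼ off) (rank-I₂ m a b (suc off)))
                      (<⇒⋠ (ℕP.≤-trans (s≤s (ℕP.m≤m+n off m)) off+1+m≤b)))
  S≡0 : S ≡ 0ℚ
  S≡0 = ∑-zero (λ k → cong 𝟙 (trans (cong (λ z → (off ≼ z) ∧ (z ≼ off)) (rank-nc m a b (suc off) k))
          (trans (cong ((off ≼ (toℕ k ℕ.+ suc off)) ∧_) (<⇒⋠ (ℕP.m≤n+m (suc off) (toℕ k))))
                 (𝔹P.∧-zeroʳ _))))
  t+T : t + T ≡ 𝟙 (taken a off (suc m))
  t+T = trans (cong (λ z → 𝟙 ((off ≼ z) ∧ (z ≼ off)) + T) (rank-I₁ m a b (suc off)))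
        (trans (taken-suc off a (off ℕ.+ m) (ℕP.m≤m+n off m))
               (cong (λ z → 𝟙 ((off ≼ a) ∧ not (z ≼ a))) (sym (ℕP.+-suc off m))))

i₁Last i₁AboveI₂ i₁TiedI₂ : ∀ m → WeakOrder (2 ℕ.+ m)
i₁Last    m = ranked m (suc m) m 0
i₁AboveI₂ m = ranked m m (suc m) 0
i₁TiedI₂  m = ranked m m m 0

i₁Tied : ∀ m → Fin m → WeakOrder (2 ℕ.+ m)
i₁Tied m k = ranked m (toℕ k) m 0

i₁Last-face : ∀ m → IsFace m (i₁Last m)
i₁Last-face m = trans (dotᶜ-ranked m (suc m) m 0 ℕP.≤-refl)
  (trans (cong₂ (λ x y → ((rhsᶜ m - 1ℚ) + 𝟙 x) + 𝟙 (true ∧ not y)) (≤⇒≼ (ℕP.n≤1+n m)) (≤⇒≼ (ℕP.n≤1+n m)))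
         (solve 1 (λ q → ((q :- con 1ℚ) :+ con 1ℚ) :+ con 0ℚ := q) refl (rhsᶜ m)))

i₁AboveI₂-value : ∀ m → dotᶜ m (i₁AboveI₂ m) ≡ rhsᶜ m - 1ℚ
i₁AboveI₂-value m = trans (dotᶜ-ranked m m (suc m) 0 (ℕP.n≤1+n m))
  (trans (cong₂ (λ x y → ((rhsᶜ m - 1ℚ) + 𝟙 x) + 𝟙 (true ∧ not y)) (<⇒⋠ (ℕP.n<1+n m)) (≼-refl m))
         (solve 1 (λ q → ((q :- con 1ℚ) :+ con 0ℚ) :+ con 0ℚ := q :- con 1ℚ) refl (rhsᶜ m)))

i₁TiedI₂-face : ∀ m → IsFace m (i₁TiedI₂ m)
i₁TiedI₂-face m = trans (dotᶜ-ranked m m m 0 ℕP.≤-refl)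
  (trans (cong₂ (λ x y → ((rhsᶜ m - 1ℚ) + 𝟙 x) + 𝟙 (true ∧ not y)) (≼-refl m) (≼-refl m))
         (solve 1 (λ q → ((q :- con 1ℚ) :+ con 1ℚ) :+ con 0ℚ := q) refl (rhsᶜ m)))

i₁Tied-face : ∀ m k → IsFace m (i₁Tied m k)
i₁Tied-face m k = trans (dotᶜ-ranked m (toℕ k) m 0 ℕP.≤-refl)
  (trans (cong₂ (λ x y → ((rhsᶜ m - 1ℚ) + 𝟙 x) + 𝟙 (true ∧ not y)) (<⇒⋠ (toℕ<n k)) (<⇒⋠ (toℕ<n k)))
         (solve 1 (λ q → ((q :- con 1ℚ) :+ con 0ℚ) :+ con 1ℚ := q) refl (rhsᶜ m)))

justBelow-i₁Last-face : ∀ m (k : Fin m) → IsFace (suc m) (justBelow (i₁Last m) (nc k))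
justBelow-i₁Last-face m k = justBelow-face m (i₁Last m) (nc k)
  (trans (cong₂ _≼_ (rank-I₂ m (suc m) m 0) (rank-nc₀ m (suc m) m k)) (<⇒⋠ (toℕ<n k))) (i₁Last-face m)

justBelow-i₁Tied-face : ∀ m (k : Fin m) → IsFace (suc m) (justBelow (i₁Tied m k) (I₁ m))
justBelow-i₁Tied-face m k = justBelow-face m (i₁Tied m k) (I₁ m)
  (trans (cong₂ _≼_ (rank-I₂ m (toℕ k) m 0) (rank-I₁ m (toℕ k) m 0)) (<⇒⋠ (toℕ<n k))) (i₁Tied-face m k)

ties-with-I₁-none : ∀ m a b → m ℕ.≤ a → ∑ᶜ m (λ j → 𝟙 (tie (ranked m a b 0) (I₁ m) j)) ≡ 0ℚ
ties-with-I₁-none m a b m≤a = ∑-zero (λ k → cong 𝟙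
  (trans (cong₂ (λ x y → (x ≼ y) ∧ (y ≼ x)) (rank-I₁ m a b 0) (rank-nc₀ m a b k))
         (trans (cong₂ _∧_ (<⇒⋠ (ℕP.<-≤-trans (toℕ<n k) m≤a)) (≤⇒≼ (ℕP.≤-trans (ℕP.<⇒≤ (toℕ<n k)) m≤a))) refl)))

tie-toℕ : ∀ {m} (k j : Fin m) → 𝟙 ((toℕ k ≼ toℕ j) ∧ (toℕ j ≼ toℕ k)) ≡ basis k j
tie-toℕ zero    zero    = refl
tie-toℕ zero    (suc j) = refl
tie-toℕ (suc k) zero    = refl
tie-toℕ (suc k) (suc j) = trans (tie-toℕ k j) (sym (cong 𝟙 (⌊suc⌋ k j)))

tiedWith-i₁AboveI₂-face : ∀ m → IsFace (suc m) (tiedWith (i₁AboveI₂ m) (I₁ m))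
tiedWith-i₁AboveI₂-face m = tiedWithI₁-face m (i₁AboveI₂ m)
  (trans (cong 𝟙 (trans (cong₂ _≼_ (rank-I₂ m m (suc m) 0) (rank-I₁ m m (suc m) 0)) (<⇒⋠ (ℕP.n<1+n m))))
  (trans (solve 1 (λ q → con 0ℚ := (con 1ℚ :- con 0ℚ) :+ ((q :- con 1ℚ) :- q)) refl (rhsᶜ m))
         (cong₂ (λ S d → (1ℚ - S) + (d - rhsᶜ m)) (sym (ties-with-I₁-none m m (suc m) ℕP.≤-refl)) (sym (i₁AboveI₂-value m)))))

tiedWith-i₁Last-face : ∀ m → IsFace (suc m) (tiedWith (i₁Last m) (I₁ m))
tiedWith-i₁Last-face m = tiedWithI₁-face m (i₁Last m)
  (trans (cong 𝟙 (trans (cong₂ _≼_ (rank-I₂ m (suc m) m 0) (rank-I₁ m (suc m) m 0)) (≤⇒≼ (ℕP.n≤1+n m))))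
  (trans (solve 1 (λ q → con 1ℚ := (con 1ℚ :- con 0ℚ) :+ (q :- q)) refl (rhsᶜ m))
         (cong₂ (λ S d → (1ℚ - S) + (d - rhsᶜ m)) (sym (ties-with-I₁-none m (suc m) m (ℕP.n≤1+n m))) (sym (i₁Last-face m)))))

tiedWith-i₁TiedI₂-face : ∀ m → IsFace (suc m) (tiedWith (i₁TiedI₂ m) (I₁ m))
tiedWith-i₁TiedI₂-face m = tiedWithI₁-face m (i₁TiedI₂ m)
  (trans (cong 𝟙 (trans (cong₂ _≼_ (rank-I₂ m m m 0) (rank-I₁ m m m 0)) (≼-refl m)))
  (trans (solve 1 (λ q → con 1ℚ := (con 1ℚ :- con 0ℚ) :+ (q :- q)) refl (rhsᶜ m))
         (cong₂ (λ S d → (1ℚ - S) + (d - rhsᶜ m)) (sym (ties-with-I₁-none m m m ℕP.≤-refl)) (sym (i₁TiedI₂-face m)))))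

tiedWith-i₁Tied-face : ∀ m (k : Fin m) → IsFace (suc m) (tiedWith (i₁Tied m k) (I₁ m))
tiedWith-i₁Tied-face m k = tiedWithI₁-face m (i₁Tied m k)
  (trans (cong 𝟙 (trans (cong₂ _≼_ (rank-I₂ m (toℕ k) m 0) (rank-I₁ m (toℕ k) m 0)) (<⇒⋠ (toℕ<n k))))
  (trans (solve 1 (λ q → con 0ℚ := (con 1ℚ :- con 1ℚ) :+ (q :- q)) refl (rhsᶜ m))
         (cong₂ (λ S d → (1ℚ - S) + (d - rhsᶜ m)) (sym one-tie) (sym (i₁Tied-face m k)))))
  where
  one-tie : ∑ᶜ m (λ j → 𝟙 (tie (i₁Tied m k) (I₁ m) j)) ≡ 1ℚ
  one-tie = trans (∑-cong (λ j → trans (cong₂ (λ x y → 𝟙 ((x ≼ y) ∧ (y ≼ x))) (rank-I₁ m (toℕ k) m 0) (rank-nc₀ m (toℕ k) m j))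
                                       (trans (tie-toℕ k j) (sym (ℚP.*-identityʳ (basis k j))))))
                  (∑-basisˡ k (λ _ → 1ℚ))

toℕ-I₁ : ∀ m → toℕ (I₁ m) ≡ suc m
toℕ-I₁ zero    = refl
toℕ-I₁ (suc m) = cong suc (toℕ-I₁ m)

toℕ-I₂ : ∀ m → toℕ (I₂ m) ≡ m
toℕ-I₂ zero    = refl
toℕ-I₂ (suc m) = cong suc (toℕ-I₂ m)

toℕ-nc : ∀ {m} (k : Fin m) → toℕ (nc k) ≡ toℕ k
toℕ-nc zero    = refl
toℕ-nc (suc k) = cong suc (toℕ-nc k)

rank-i₁Last : ∀ m j → rank m (suc m) m 0 j ≡ toℕ j
rank-i₁Last m j with label m j
... | isI₁   = trans (rank-I₁ m (suc m) m 0) (sym (toℕ-I₁ m))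
... | isI₂   = trans (rank-I₂ m (suc m) m 0) (sym (toℕ-I₂ m))
... | isNc k = trans (rank-nc₀ m (suc m) m k) (sym (toℕ-nc k))

⌊nc⌋ : ∀ {m} (k k′ : Fin m) → ⌊ nc k ≟ nc k′ ⌋ ≡ ⌊ k ≟ k′ ⌋
⌊nc⌋ zero    zero     = refl
⌊nc⌋ zero    (suc k′) = refl
⌊nc⌋ (suc k) zero     = refl
⌊nc⌋ (suc k) (suc k′) = trans (⌊suc⌋ (nc k) (nc k′)) (trans (⌊nc⌋ k k′) (sym (⌊suc⌋ k k′)))

prefix : ∀ {m} → ℕ → Fin (2 ℕ.+ m) → ℚ
prefix l j = 𝟙 (suc (toℕ j) ≼ l)

prefix-I₁ : ∀ m l → l ℕ.≤ m → prefix l (I₁ m) ≡ 0ℚ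
prefix-I₁ m l l≤m = cong 𝟙 (trans (cong (λ z → suc z ≼ l) (toℕ-I₁ m)) (<⇒⋠ (s≤s (ℕP.≤-trans l≤m (ℕP.n≤1+n m)))))

prefix-I₂ : ∀ m l → l ℕ.≤ m → prefix l (I₂ m) ≡ 0ℚ
prefix-I₂ m l l≤m = cong 𝟙 (trans (cong (λ z → suc z ≼ l) (toℕ-I₂ m)) (<⇒⋠ (s≤s l≤m)))

prefix-nc : ∀ m l (k : Fin m) → prefix l (nc k) ≡ 𝟙 (suc (toℕ k) ≼ l)
prefix-nc m l k = cong (λ z → 𝟙 (suc z ≼ l)) (toℕ-nc k)

prefix-all : ∀ m (k : Fin m) → prefix m (nc k) ≡ 1ℚ
prefix-all m k = trans (prefix-nc m m k) (cong 𝟙 (≤⇒≼ (toℕ<n k)))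

𝟙≼-step : ∀ x y → 𝟙 (x ≼ y) - 𝟙 (suc x ≼ y) ≡ 𝟙 ((x ≼ y) ∧ (y ≼ x))
𝟙≼-step zero    zero    = refl
𝟙≼-step zero    (suc y) = refl
𝟙≼-step (suc x) zero    = refl
𝟙≼-step (suc x) (suc y) = 𝟙≼-step x y

𝟙≼-neg : ∀ x y → 𝟙 (x ≼ y) - 1ℚ ≡ - 𝟙 (suc y ≼ x)
𝟙≼-neg zero    zero    = refl
𝟙≼-neg zero    (suc y) = refl
𝟙≼-neg (suc x) zero    = refl
𝟙≼-neg (suc x) (suc y) = 𝟙≼-neg x y

𝟙-not : ∀ x → 𝟙 (not x) - 1ℚ ≡ - 𝟙 x
𝟙-not true  = refl
𝟙-not false = refl

prefix-step : ∀ m (k : Fin m) j → prefix (suc (toℕ k)) j - prefix (toℕ k) j ≡ basis (nc k) j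
prefix-step m k j with label m j
... | isI₁ = trans (cong₂ _-_ (prefix-I₁ m (suc (toℕ k)) (toℕ<n k)) (prefix-I₁ m (toℕ k) (ℕP.<⇒≤ (toℕ<n k))))
                   (sym (basis-off (nc≢I₁ k)))
... | isI₂ = trans (cong₂ _-_ (prefix-I₂ m (suc (toℕ k)) (toℕ<n k)) (prefix-I₂ m (toℕ k) (ℕP.<⇒≤ (toℕ<n k))))
                   (sym (basis-off (nc≢I₂ k)))
... | isNc k′ = begin
  prefix (suc (toℕ k)) (nc k′) - prefix (toℕ k) (nc k′)   ≡⟨ cong₂ _-_ (prefix-nc m (suc (toℕ k)) k′) (prefix-nc m (toℕ k) k′) ⟩
  𝟙 (toℕ k′ ≼ toℕ k) - 𝟙 (suc (toℕ k′) ≼ toℕ k)           ≡⟨ 𝟙≼-step (toℕ k′) (toℕ k) ⟩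
  𝟙 ((toℕ k′ ≼ toℕ k) ∧ (toℕ k ≼ toℕ k′))                 ≡⟨ cong 𝟙 (𝔹P.∧-comm (toℕ k′ ≼ toℕ k) (toℕ k ≼ toℕ k′)) ⟩
  𝟙 ((toℕ k ≼ toℕ k′) ∧ (toℕ k′ ≼ toℕ k))                 ≡⟨ tie-toℕ k k′ ⟩
  basis k k′                                               ≡⟨ cong 𝟙 (⌊nc⌋ k k′) ⟨
  basis (nc k) (nc k′)                                     ∎
  where open ≡-Reasoning

module _ (m : ℕ) where

  out-justBelow-i₁Last : ∀ (k : Fin m) j → outArc (justBelow (i₁Last m) (nc k)) j ≡ - prefix (suc (toℕ k)) j
  out-justBelow-i₁Last k j rewrite rank-i₁Last m j | rank-nc₀ m (suc m) m k = 𝟙-not (toℕ j ≼ toℕ k)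
  in-justBelow-i₁Last : ∀ (k : Fin m) j → inArc (justBelow (i₁Last m) (nc k)) j ≡ prefix (suc (toℕ k)) j
  in-justBelow-i₁Last k j rewrite rank-i₁Last m j | rank-nc₀ m (suc m) m k = refl

  out-tiedWith-i₁AboveI₂ : ∀ j → outArc (tiedWith (i₁AboveI₂ m) (I₁ m)) j ≡ - prefix m j
  out-tiedWith-i₁AboveI₂ j with label m j
  ... | isI₁   rewrite rank-I₁ m m (suc m) 0 | ≼-refl m | prefix-I₁ m m ℕP.≤-refl = refl
  ... | isI₂   rewrite rank-I₁ m m (suc m) 0 | rank-I₂ m m (suc m) 0 | ≤⇒≼ (ℕP.n≤1+n m) | prefix-I₂ m m ℕP.≤-refl = refl
  ... | isNc k rewrite rank-I₁ m m (suc m) 0 | rank-nc₀ m m (suc m) k | <⇒⋠ (toℕ<n k) | prefix-all m k = refl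
  in-tiedWith-i₁AboveI₂ : ∀ j → inArc (tiedWith (i₁AboveI₂ m) (I₁ m)) j ≡ prefix m j + basis (I₁ m) j
  in-tiedWith-i₁AboveI₂ j with label m j
  ... | isI₁   rewrite rank-I₁ m m (suc m) 0 | ≼-refl m | prefix-I₁ m m ℕP.≤-refl | basis-diag (I₁ m) = refl
  ... | isI₂   rewrite rank-I₁ m m (suc m) 0 | rank-I₂ m m (suc m) 0 | <⇒⋠ (ℕP.n<1+n m) | prefix-I₂ m m ℕP.≤-refl
                     | basis-off (I₁≢I₂ m) = refl
  ... | isNc k rewrite rank-I₁ m m (suc m) 0 | rank-nc₀ m m (suc m) k | ≤⇒≼ (ℕP.<⇒≤ (toℕ<n k)) | prefix-all m k
                     | basis-off (nc≢I₁ k ∘ sym) = refl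

  out-tiedWith-i₁Tied : ∀ (k : Fin m) j → outArc (tiedWith (i₁Tied m k) (I₁ m)) j ≡ - prefix (toℕ k) j
  out-tiedWith-i₁Tied k j with label m j
  ... | isI₁    rewrite rank-I₁ m (toℕ k) m 0 | ≼-refl (toℕ k) | prefix-I₁ m (toℕ k) (ℕP.<⇒≤ (toℕ<n k)) = refl
  ... | isI₂    rewrite rank-I₁ m (toℕ k) m 0 | rank-I₂ m (toℕ k) m 0 | ≤⇒≼ (ℕP.<⇒≤ (toℕ<n k))
                      | prefix-I₂ m (toℕ k) (ℕP.<⇒≤ (toℕ<n k)) = refl
  ... | isNc k′ rewrite rank-I₁ m (toℕ k) m 0 | rank-nc₀ m (toℕ k) m k′ | prefix-nc m (toℕ k) k′ = 𝟙≼-neg (toℕ k) (toℕ k′)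
  in-tiedWith-i₁Tied : ∀ (k : Fin m) j → inArc (tiedWith (i₁Tied m k) (I₁ m)) j ≡ prefix (suc (toℕ k)) j + basis (I₁ m) j
  in-tiedWith-i₁Tied k j with label m j
  ... | isI₁    rewrite rank-I₁ m (toℕ k) m 0 | ≼-refl (toℕ k) | prefix-I₁ m (suc (toℕ k)) (toℕ<n k) | basis-diag (I₁ m) = refl
  ... | isI₂    rewrite rank-I₁ m (toℕ k) m 0 | rank-I₂ m (toℕ k) m 0 | <⇒⋠ (toℕ<n k) | prefix-I₂ m (suc (toℕ k)) (toℕ<n k)
                      | basis-off (I₁≢I₂ m) = refl
  ... | isNc k′ rewrite rank-I₁ m (toℕ k) m 0 | rank-nc₀ m (toℕ k) m k′ | prefix-nc m (suc (toℕ k)) k′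
                      | basis-off (nc≢I₁ k′ ∘ sym) = sym (ℚP.+-identityʳ _)

  out-tiedWith-i₁Last : ∀ j → outArc (tiedWith (i₁Last m) (I₁ m)) j ≡ - prefix m j - basis (I₂ m) j
  out-tiedWith-i₁Last j with label m j
  ... | isI₁   rewrite rank-I₁ m (suc m) m 0 | ≼-refl m | prefix-I₁ m m ℕP.≤-refl | basis-off (I₁≢I₂ m ∘ sym) = refl
  ... | isI₂   rewrite rank-I₁ m (suc m) m 0 | rank-I₂ m (suc m) m 0 | <⇒⋠ (ℕP.n<1+n m) | prefix-I₂ m m ℕP.≤-refl
                     | basis-diag (I₂ m) = refl
  ... | isNc k rewrite rank-I₁ m (suc m) m 0 | rank-nc₀ m (suc m) m k | <⇒⋠ (ℕP.<-trans (toℕ<n k) (ℕP.n<1+n m))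
                     | prefix-all m k | basis-off (nc≢I₂ k ∘ sym) = refl
  in-tiedWith-i₁Last : ∀ j → inArc (tiedWith (i₁Last m) (I₁ m)) j ≡ (prefix m j + basis (I₂ m) j) + basis (I₁ m) j
  in-tiedWith-i₁Last j with label m j
  ... | isI₁   rewrite rank-I₁ m (suc m) m 0 | ≼-refl m | prefix-I₁ m m ℕP.≤-refl | basis-off (I₁≢I₂ m ∘ sym)
                     | basis-diag (I₁ m) = refl
  ... | isI₂   rewrite rank-I₁ m (suc m) m 0 | rank-I₂ m (suc m) m 0 | ≤⇒≼ (ℕP.n≤1+n m) | prefix-I₂ m m ℕP.≤-refl
                     | basis-diag (I₂ m) | basis-off (I₁≢I₂ m) = refl
  ... | isNc k rewrite rank-I₁ m (suc m) m 0 | rank-nc₀ m (suc m) m k | ≤⇒≼ (ℕP.≤-trans (ℕP.<⇒≤ (toℕ<n k)) (ℕP.n≤1+n m))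
                     | prefix-all m k | basis-off (nc≢I₂ k ∘ sym) | basis-off (nc≢I₁ k ∘ sym) = refl

  out-tiedWith-i₁TiedI₂ : ∀ j → outArc (tiedWith (i₁TiedI₂ m) (I₁ m)) j ≡ - prefix m j
  out-tiedWith-i₁TiedI₂ j with label m j
  ... | isI₁   rewrite rank-I₁ m m m 0 | ≼-refl m | prefix-I₁ m m ℕP.≤-refl = refl
  ... | isI₂   rewrite rank-I₁ m m m 0 | rank-I₂ m m m 0 | ≼-refl m | prefix-I₂ m m ℕP.≤-refl = refl
  ... | isNc k rewrite rank-I₁ m m m 0 | rank-nc₀ m m m k | <⇒⋠ (toℕ<n k) | prefix-all m k = refl
  in-tiedWith-i₁TiedI₂ : ∀ j → inArc (tiedWith (i₁TiedI₂ m) (I₁ m)) j ≡ (prefix m j + basis (I₂ m) j) + basis (I₁ m) j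
  in-tiedWith-i₁TiedI₂ j with label m j
  ... | isI₁   rewrite rank-I₁ m m m 0 | ≼-refl m | prefix-I₁ m m ℕP.≤-refl | basis-off (I₁≢I₂ m ∘ sym)
                     | basis-diag (I₁ m) = refl
  ... | isI₂   rewrite rank-I₁ m m m 0 | rank-I₂ m m m 0 | ≼-refl m | prefix-I₂ m m ℕP.≤-refl | basis-diag (I₂ m)
                     | basis-off (I₁≢I₂ m) = refl
  ... | isNc k rewrite rank-I₁ m m m 0 | rank-nc₀ m m m k | ≤⇒≼ (ℕP.<⇒≤ (toℕ<n k)) | prefix-all m k
                     | basis-off (nc≢I₂ k ∘ sym) | basis-off (nc≢I₁ k ∘ sym) = refl

module _ (m′ : ℕ) where

  private
    m = suc m′

  out-justBelow-i₁Tied : ∀ j → outArc (justBelow (i₁Tied m (fromℕ m′)) (I₁ m)) j ≡ - prefix m j - basis (I₁ m) j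
  out-justBelow-i₁Tied j with label m j
  ... | isI₁   rewrite rank-I₁ m (toℕ (fromℕ m′)) m 0 | toℕ-fromℕ m′ | ≼-refl m′ | prefix-I₁ m m ℕP.≤-refl
                     | basis-diag (I₁ m) = refl
  ... | isI₂   rewrite rank-I₁ m (toℕ (fromℕ m′)) m 0 | rank-I₂ m (toℕ (fromℕ m′)) m 0 | toℕ-fromℕ m′
                     | <⇒⋠ (ℕP.n<1+n m′) | prefix-I₂ m m ℕP.≤-refl | basis-off (I₁≢I₂ m) = refl
  ... | isNc k rewrite rank-I₁ m (toℕ (fromℕ m′)) m 0 | rank-nc₀ m (toℕ (fromℕ m′)) m k | toℕ-fromℕ m′
                     | ≤⇒≼ (ℕP.≤-pred (toℕ<n k)) | prefix-all m k | basis-off (nc≢I₁ k ∘ sym) = refl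
  in-justBelow-i₁Tied : ∀ j → inArc (justBelow (i₁Tied m (fromℕ m′)) (I₁ m)) j ≡ prefix m j + basis (I₁ m) j
  in-justBelow-i₁Tied j with label m j
  ... | isI₁   rewrite rank-I₁ m (toℕ (fromℕ m′)) m 0 | toℕ-fromℕ m′ | ≼-refl m′ | prefix-I₁ m m ℕP.≤-refl
                     | basis-diag (I₁ m) = refl
  ... | isI₂   rewrite rank-I₁ m (toℕ (fromℕ m′)) m 0 | rank-I₂ m (toℕ (fromℕ m′)) m 0 | toℕ-fromℕ m′
                     | <⇒⋠ (ℕP.n<1+n m′) | prefix-I₂ m m ℕP.≤-refl | basis-off (I₁≢I₂ m) = refl
  ... | isNc k rewrite rank-I₁ m (toℕ (fromℕ m′)) m 0 | rank-nc₀ m (toℕ (fromℕ m′)) m k | toℕ-fromℕ m′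
                     | ≤⇒≼ (ℕP.≤-pred (toℕ<n k)) | prefix-all m k | basis-off (nc≢I₁ k ∘ sym) = refl

-- Spanning families

label-I₁ : ∀ m → label m (I₁ m) ≡ isI₁
label-I₁ zero = refl
label-I₁ (suc m) rewrite label-I₁ m = refl

label-I₂ : ∀ m → label m (I₂ m) ≡ isI₂
label-I₂ zero = refl
label-I₂ (suc m) rewrite label-I₂ m = refl

label-nc : ∀ m (k : Fin m) → label m (nc k) ≡ isNc k
label-nc (suc m) zero = refl
label-nc (suc m) (suc k) rewrite label-nc m k = refl

record Witnesses (m : ℕ) : Set where
  field
    family  : Fin (suc (arcs (2 ℕ.+ m))) → WeakOrder (2 ℕ.+ m)
    spans   : ∀ v → Span (λ t → homog (χ (family t))) v
    offFace : dotᶜ m (family zero) ≢ rhsᶜ m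
    onFace  : ∀ t → IsFace m (family (suc t))

homog-onTop : ∀ {n} (W : WeakOrder n) t → homog (χ (onTop W)) t ≡ raise {n} (homog (χ W)) t
homog-onTop {n} W t = trans (homog-split (onTop W) t)
  (trans (cong (raise {n} (homog (χ W)) t +_) (onNewArcs-zero {n} t)) (ℚP.+-identityʳ _))

-- The step from Fin (2 + m) to Fin (3 + m): all old witnesses put below a new top element, plus 2n new
-- orders on the face whose coordinates on the new arcs span.
module Step (m′ : ℕ) where

  private
    m = suc m′
    n = 2 ℕ.+ m

  newOut newIn : ∀ j → Label m j → WeakOrder (suc n)
  newOut .(nc k) (isNc k) = justBelow (i₁Last m) (nc k)
  newOut .(I₂ m) isI₂     = tiedWith (i₁AboveI₂ m) (I₁ m)
  newOut .(I₁ m) isI₁     = justBelow (i₁Tied m (fromℕ m′)) (I₁ m)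
  newIn .(nc k) (isNc k) = tiedWith (i₁Tied m k) (I₁ m)
  newIn .(I₂ m) isI₂     = tiedWith (i₁Last m) (I₁ m)
  newIn .(I₁ m) isI₁     = tiedWith (i₁TiedI₂ m) (I₁ m)

  new : Fin (n ℕ.+ n) → WeakOrder (suc n)
  new s = [ (λ j → newOut j (label m j)) , (λ j → newIn j (label m j)) ]′ (splitAt n s)

  new-face : ∀ s → IsFace (suc m) (new s)
  new-face s with splitAt n s
  ... | inj₁ j = out-face j (label m j)
    where
    out-face : ∀ j (l : Label m j) → IsFace (suc m) (newOut j l)
    out-face .(nc k) (isNc k) = justBelow-i₁Last-face m k
    out-face .(I₂ m) isI₂     = tiedWith-i₁AboveI₂-face m
    out-face .(I₁ m) isI₁     = justBelow-i₁Tied-face m (fromℕ m′)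
  ... | inj₂ j = in-face j (label m j)
    where
    in-face : ∀ j (l : Label m j) → IsFace (suc m) (newIn j l)
    in-face .(nc k) (isNc k) = tiedWith-i₁Tied-face m k
    in-face .(I₂ m) isI₂     = tiedWith-i₁Last-face m
    in-face .(I₁ m) isI₁     = tiedWith-i₁TiedI₂-face m

  extend : (Fin (suc (arcs n)) → WeakOrder n) → Fin (suc (arcs (suc n))) → WeakOrder (suc n)
  extend fam zero    = onTop (fam zero)
  extend fam (suc t) = [ new , (λ t′ → onTop (fam (suc t′))) ]′ (splitAt (n ℕ.+ n) t)

  module _ (fam : Fin (suc (arcs n)) → WeakOrder n) (spans : ∀ v → Span (λ t → homog (χ (fam t))) v) where

    private
      u : Fin (suc (arcs (suc n))) → Fin (suc (arcs (suc n))) → ℚ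
      u t = homog (χ (extend fam t))

    raise-spans : ∀ v → Span u (raise {n} v)
    raise-spans v = Span-mono raised (Span-map raise-linear (spans v))
      where
      raised : ∀ t → Span u (raise {n} (homog (χ (fam t))))
      raised zero     = ext (homog-onTop (fam zero)) (gen zero)
      raised (suc t′) = ext (λ x → trans (cong (λ W → homog (χ W) x) extend-old) (homog-onTop (fam (suc t′)) x))
                            (gen (suc ((n ℕ.+ n) ↑ʳ t′)))
        where
        extend-old : extend fam (suc ((n ℕ.+ n) ↑ʳ t′)) ≡ onTop (fam (suc t′))
        extend-old = cong [ new , (λ t′ → onTop (fam (suc t′))) ]′ (splitAt-↑ʳ (n ℕ.+ n) (arcs n) t′)

    SpanNew : (Fin n → ℚ) → (Fin n → ℚ) → Set
    SpanNew f g = Span u (onNewArcs f g)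

    new-spans : ∀ s → SpanNew (outArc (new s)) (inArc (new s))
    new-spans s = ext (λ t → trans (cong (_- raise {n} (homog (χ (restrict w))) t) (homog-split w t))
                               (solve 2 (λ a b → (a :+ b) :- a := b) refl (raise {n} (homog (χ (restrict w))) t) (onNewArcs (outArc w) (inArc w) t)))
                      (span-minus (ext (λ x → cong (λ W → homog (χ W) x) extend-new) (gen (suc (s ↑ˡ arcs n))))
                              (raise-spans (homog (χ (restrict w)))))
      where
      w = new s
      extend-new : extend fam (suc (s ↑ˡ arcs n)) ≡ new s
      extend-new = cong [ new , (λ t′ → onTop (fam (suc t′))) ]′ (splitAt-↑ˡ (n ℕ.+ n) s (arcs n))

    spanNew-ext : ∀ {f g f′ g′} → (∀ j → f j ≡ f′ j) → (∀ j → g j ≡ g′ j) → SpanNew f g → SpanNew f′ g′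
    spanNew-ext f≡ g≡ = ext (onNewArcs-cong f≡ g≡)

    spanNew-minus : ∀ {f₁ g₁ f₂ g₂} → SpanNew f₁ g₁ → SpanNew f₂ g₂ → SpanNew (λ j → f₁ j - f₂ j) (λ j → g₁ j - g₂ j)
    spanNew-minus {f₁} {g₁} {f₂} {g₂} s₁ s₂ =
      spanNew-ext (λ j → solve 2 (λ x y → :- con 1ℚ :* y :+ x := x :- y) refl (f₁ j) (f₂ j))
                  (λ j → solve 2 (λ x y → :- con 1ℚ :* y :+ x := x :- y) refl (g₁ j) (g₂ j))
                  (ext (λ t → sym (onNewArcs-lin (- 1ℚ) f₂ g₂ f₁ g₁ t)) (lin (- 1ℚ) s₂ s₁))

    spanNewOut : ∀ j {f g} → (∀ i → outArc (newOut j (label m j)) i ≡ f i) →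
      (∀ i → inArc (newOut j (label m j)) i ≡ g i) → SpanNew f g
    spanNewOut j f≡ g≡ = spanNew-ext (λ i → trans (cong (λ w → outArc w i) e) (f≡ i))
                                     (λ i → trans (cong (λ w → inArc w i) e) (g≡ i)) (new-spans (j ↑ˡ n))
      where
      e : new (j ↑ˡ n) ≡ newOut j (label m j)
      e = cong [ (λ j → newOut j (label m j)) , (λ j → newIn j (label m j)) ]′ (splitAt-↑ˡ n j n)

    spanNewIn : ∀ j {f g} → (∀ i → outArc (newIn j (label m j)) i ≡ f i) →
      (∀ i → inArc (newIn j (label m j)) i ≡ g i) → SpanNew f g
    spanNewIn j f≡ g≡ = spanNew-ext (λ i → trans (cong (λ w → outArc w i) e) (f≡ i))
                                    (λ i → trans (cong (λ w → inArc w i) e) (g≡ i)) (new-spans (n ↑ʳ j))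
      where
      e : new (n ↑ʳ j) ≡ newIn j (label m j)
      e = cong [ (λ j → newOut j (label m j)) , (λ j → newIn j (label m j)) ]′ (splitAt-↑ʳ n n j)

    eI₁ eI₂ : Fin n → ℚ
    eI₁ = basis (I₁ m)
    eI₂ = basis (I₂ m)

    prefixes : ∀ l → l ℕ.≤ m → SpanNew (λ j → - prefix l j) (prefix l)
    prefixes zero    _   = spanNew-ext (λ _ → refl) (λ _ → refl)
                             (ext (λ t → sym (onNewArcs-zero {n} t)) zer)
    prefixes (suc l) l<m =
      spanNew-ext (λ j → cong (λ z → - prefix (suc z) j) k≡l) (λ j → cong (λ z → prefix (suc z) j) k≡l)
        (spanNewOut (nc k) (λ i → trans (cong (λ l → outArc (newOut (nc k) l) i) (label-nc m k)) (out-justBelow-i₁Last m k i))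
                           (λ i → trans (cong (λ l → inArc (newOut (nc k) l) i) (label-nc m k)) (in-justBelow-i₁Last m k i)))
      where
      k = fromℕ< l<m
      k≡l = toℕ-fromℕ< l<m

    all-prefix = prefixes m ℕP.≤-refl

    in-I₁ : SpanNew (λ _ → 0ℚ) eI₁
    in-I₁ = spanNew-ext (λ j → solve 1 (λ q → (:- q) :- (:- q) := con 0ℚ) refl (prefix m j))
                        (λ j → solve 2 (λ q e → (q :+ e) :- q := e) refl (prefix m j) (eI₁ j))
      (spanNew-minus (spanNewOut (I₂ m) (λ i → trans (cong (λ l → outArc (newOut (I₂ m) l) i) (label-I₂ m)) (out-tiedWith-i₁AboveI₂ m i))
                                    (λ i → trans (cong (λ l → inArc (newOut (I₂ m) l) i) (label-I₂ m)) (in-tiedWith-i₁AboveI₂ m i)))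
                 all-prefix)

    out-I₁ : SpanNew eI₁ (λ _ → 0ℚ)
    out-I₁ = spanNew-ext (λ j → solve 2 (λ q e → con 0ℚ :- (((:- q) :- e) :- (:- q)) := e) refl (prefix m j) (eI₁ j))
                         (λ j → solve 2 (λ q e → e :- ((q :+ e) :- q) := con 0ℚ) refl (prefix m j) (eI₁ j))
      (spanNew-minus in-I₁ (spanNew-minus (spanNewOut (I₁ m) (λ i → trans (cong (λ l → outArc (newOut (I₁ m) l) i) (label-I₁ m)) (out-justBelow-i₁Tied m′ i))
                                                     (λ i → trans (cong (λ l → inArc (newOut (I₁ m) l) i) (label-I₁ m)) (in-justBelow-i₁Tied m′ i)))
                                  all-prefix))

    tiedI₁-minus-prefixes : ∀ (k : Fin m) → SpanNew (λ _ → 0ℚ) (λ j → prefix (suc (toℕ k)) j - prefix (toℕ k) j)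
    tiedI₁-minus-prefixes k =
      spanNew-ext (λ j → solve 1 (λ q → ((:- q) :- (:- q)) :- con 0ℚ := con 0ℚ) refl (prefix (toℕ k) j))
                  (λ j → solve 3 (λ a b e → ((a :+ e) :- b) :- e := a :- b) refl (prefix (suc (toℕ k)) j) (prefix (toℕ k) j) (eI₁ j))
        (spanNew-minus (spanNew-minus (spanNewIn (nc k) (λ i → trans (cong (λ l → outArc (newIn (nc k) l) i) (label-nc m k)) (out-tiedWith-i₁Tied m k i))
                                                (λ i → trans (cong (λ l → inArc (newIn (nc k) l) i) (label-nc m k)) (in-tiedWith-i₁Tied m k i)))
                              (prefixes (toℕ k) (ℕP.<⇒≤ (toℕ<n k))))
                   in-I₁)

    in-nc : ∀ (k : Fin m) → SpanNew (λ _ → 0ℚ) (basis (nc k))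
    in-nc k = spanNew-ext (λ _ → refl) (prefix-step m k) (tiedI₁-minus-prefixes k)

    out-nc : ∀ (k : Fin m) → SpanNew (basis (nc k)) (λ _ → 0ℚ)
    out-nc k = spanNew-ext (λ j → trans (solve 2 (λ a b → con 0ℚ :- ((:- a) :- (:- b)) := a :- b) refl (prefix (suc (toℕ k)) j) (prefix (toℕ k) j)) (prefix-step m k j))
                           (λ j → trans (cong (λ z → basis (nc k) j - z) (prefix-step m k j)) (ℚP.+-inverseʳ (basis (nc k) j)))
      (spanNew-minus (in-nc k) (spanNew-minus (prefixes (suc (toℕ k)) (toℕ<n k)) (prefixes (toℕ k) (ℕP.<⇒≤ (toℕ<n k)))))

    in-I₂ : SpanNew (λ _ → 0ℚ) eI₂
    in-I₂ = spanNew-ext (λ j → solve 1 (λ q → (((:- q) :- (:- q)) :- con 0ℚ) := con 0ℚ) refl (prefix m j))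
                        (λ j → solve 3 (λ q u a → (((q :+ u) :+ a) :- q) :- a := u) refl (prefix m j) (eI₂ j) (eI₁ j))
      (spanNew-minus (spanNew-minus (spanNewIn (I₁ m) (λ i → trans (cong (λ l → outArc (newIn (I₁ m) l) i) (label-I₁ m)) (out-tiedWith-i₁TiedI₂ m i))
                                              (λ i → trans (cong (λ l → inArc (newIn (I₁ m) l) i) (label-I₁ m)) (in-tiedWith-i₁TiedI₂ m i)))
                            all-prefix)
                 in-I₁)

    out-I₂ : SpanNew eI₂ (λ _ → 0ℚ)
    out-I₂ = spanNew-ext (λ j → solve 2 (λ q u → con 0ℚ :- ((((:- q) :- u) :- (:- q)) :- con 0ℚ) := u) refl (prefix m j) (eI₂ j))
                         (λ j → solve 3 (λ q u a → u :- ((((q :+ u) :+ a) :- q) :- a) := con 0ℚ) refl (prefix m j) (eI₂ j) (eI₁ j))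
      (spanNew-minus in-I₂ (spanNew-minus (spanNew-minus (spanNewIn (I₂ m) (λ i → trans (cong (λ l → outArc (newIn (I₂ m) l) i) (label-I₂ m)) (out-tiedWith-i₁Last m i))
                                                               (λ i → trans (cong (λ l → inArc (newIn (I₂ m) l) i) (label-I₂ m)) (in-tiedWith-i₁Last m i)))
                                             all-prefix)
                                  in-I₁))

    out-basis : ∀ j → SpanNew (basis j) (λ _ → 0ℚ)
    out-basis j with label m j
    ... | isI₁   = out-I₁
    ... | isI₂   = out-I₂
    ... | isNc k = out-nc k

    in-basis : ∀ j → SpanNew (λ _ → 0ℚ) (basis j)
    in-basis j with label m j
    ... | isI₁   = in-I₁
    ... | isI₂   = in-I₂
    ... | isNc k = in-nc k

    spanNew : ∀ f g → SpanNew f g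
    spanNew f g = ext (λ t → sym (onNewArcs-basis f g t))
      (span-+ (span-∑ (λ j t → f j * onNewArcs (basis j) (λ _ → 0ℚ) t) (λ j → span-* (f j) (out-basis j)))
              (span-∑ (λ j t → g j * onNewArcs (λ _ → 0ℚ) (basis j) t) (λ j → span-* (g j) (in-basis j))))

    -- Every vector is raise of its old part plus a vector on the new arcs.
    extend-spans : ∀ v → Span u v
    extend-spans v = ext (λ t → sym (split t)) (span-+ (raise-spans old) (spanNew f g))
      where
      old : Fin (suc (arcs n)) → ℚ
      old zero     = v zero
      old (suc t′) = v (suc ((n ℕ.+ n) ↑ʳ t′))
      f g : Fin n → ℚ
      f j = v (suc ((j ↑ˡ n) ↑ˡ arcs n)) - v zero
      g j = v (suc ((n ↑ʳ j) ↑ˡ arcs n))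
      split : ∀ t → v t ≡ raise {n} old t + onNewArcs f g t
      split zero = sym (ℚP.+-identityʳ (v zero))
      split (suc t) with splitAt (n ℕ.+ n) t in e₁
      ... | inj₂ t′ = trans (cong (λ x → v (suc x)) (sym (splitAt⁻¹-↑ʳ e₁))) (sym (ℚP.+-identityʳ _))
      ... | inj₁ s with splitAt n s in e₂
      ...   | inj₁ j = trans (cong (λ x → v (suc x)) (trans (sym (splitAt⁻¹-↑ˡ e₁)) (cong (_↑ˡ arcs n) (sym (splitAt⁻¹-↑ˡ e₂)))))
                             (solve 2 (λ a b → a := b :+ (a :- b)) refl (v (suc ((j ↑ˡ n) ↑ˡ arcs n))) (v zero))
      ...   | inj₂ j = trans (cong (λ x → v (suc x)) (trans (sym (splitAt⁻¹-↑ˡ e₁)) (cong (_↑ˡ arcs n) (sym (splitAt⁻¹-↑ʳ e₂)))))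
                             (sym (ℚP.+-identityˡ _))

  step : Witnesses m → Witnesses (suc m)
  step w = record
    { family  = extend family
    ; spans   = extend-spans family spans
    ; offFace = onTop-nonface m (family zero) offFace
    ; onFace  = onFace′
    }
    where
    open Witnesses w
    onFace′ : ∀ t → IsFace (suc m) (extend family (suc t))
    onFace′ t with splitAt (n ℕ.+ n) t
    ... | inj₁ s  = new-face s
    ... | inj₂ t′ = onTop-face m (family (suc t′)) (onFace t′)

-- The witnesses for n = 4, i.e. m = 2; the ranks of 0, 1 (= N̂ᶜ), 2 (= i₂) and 3 (= i₁) are listed.
module BaseCase where

  open import Agda.Builtin.FromNat using (Number; fromNat)
  open import Agda.Builtin.FromNeg using (Negative; fromNeg)
  open import Data.Unit using (tt)
  import Data.Nat.Literals as ℕLiterals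
  import Data.Rational.Literals as ℚLiterals

  private instance
    ℕ-number : Number ℕ
    ℕ-number = ℕLiterals.number
    ℚ-number : Number ℚ
    ℚ-number = ℚLiterals.number
    ℚ-negative : Negative ℚ
    ℚ-negative = ℚLiterals.negative

  ranks : Vec (Vec ℕ 4) 13
  ranks =
    (0 ∷ 1 ∷ 3 ∷ 2 ∷ []) ∷
    (0 ∷ 0 ∷ 1 ∷ 0 ∷ []) ∷
    (0 ∷ 1 ∷ 1 ∷ 1 ∷ []) ∷
    (0 ∷ 1 ∷ 2 ∷ 0 ∷ []) ∷
    (0 ∷ 1 ∷ 2 ∷ 1 ∷ []) ∷
    (0 ∷ 1 ∷ 2 ∷ 2 ∷ []) ∷
    (0 ∷ 1 ∷ 2 ∷ 3 ∷ []) ∷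
    (0 ∷ 2 ∷ 1 ∷ 2 ∷ []) ∷
    (1 ∷ 0 ∷ 1 ∷ 1 ∷ []) ∷
    (1 ∷ 0 ∷ 2 ∷ 0 ∷ []) ∷
    (1 ∷ 0 ∷ 2 ∷ 1 ∷ []) ∷
    (1 ∷ 0 ∷ 2 ∷ 2 ∷ []) ∷
    (2 ∷ 0 ∷ 1 ∷ 2 ∷ []) ∷
    []

  family : Fin 13 → WeakOrder 4
  family k = byRank (lookup (lookup ranks k))

  -- Row s writes the s-th unit vector of ℚ¹³ as a combination of the homogenised characteristic vectors.
  coefficients : Vec (Vec ℚ 13) 13
  coefficients =
    ( 2 ∷ -1 ∷ -1 ∷  1 ∷ -1 ∷  0 ∷ -1 ∷  1 ∷ -1 ∷  1 ∷ -1 ∷  1 ∷  1 ∷ []) ∷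
    ( 1 ∷  1 ∷  0 ∷  0 ∷ -1 ∷  0 ∷  0 ∷  0 ∷  0 ∷  0 ∷ -1 ∷  0 ∷  0 ∷ []) ∷
    ( 0 ∷  0 ∷  0 ∷  0 ∷  0 ∷ -1 ∷  1 ∷  0 ∷  1 ∷  0 ∷  0 ∷  0 ∷ -1 ∷ []) ∷
    (-1 ∷  0 ∷  0 ∷  0 ∷  1 ∷  0 ∷  0 ∷  0 ∷  0 ∷ -1 ∷  1 ∷  0 ∷  0 ∷ []) ∷
    ( 1 ∷  1 ∷  0 ∷  0 ∷ -1 ∷ -1 ∷  0 ∷  0 ∷  0 ∷  0 ∷ -1 ∷  1 ∷  0 ∷ []) ∷
    ( 1 ∷  0 ∷  0 ∷  0 ∷  0 ∷ -1 ∷  0 ∷  0 ∷  1 ∷  0 ∷ -1 ∷  0 ∷  0 ∷ []) ∷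
    (-1 ∷  0 ∷  0 ∷  0 ∷  0 ∷  1 ∷  0 ∷  0 ∷  0 ∷  0 ∷  1 ∷ -1 ∷  0 ∷ []) ∷
    ( 0 ∷  0 ∷  1 ∷  0 ∷  0 ∷ -1 ∷  1 ∷ -1 ∷  0 ∷  0 ∷  0 ∷  0 ∷  0 ∷ []) ∷
    (-1 ∷  0 ∷  0 ∷ -1 ∷  1 ∷  1 ∷  0 ∷  0 ∷  0 ∷  0 ∷  1 ∷ -1 ∷  0 ∷ []) ∷
    ( 1 ∷  0 ∷  1 ∷  0 ∷ -1 ∷ -1 ∷  0 ∷  0 ∷  0 ∷  0 ∷  0 ∷  0 ∷  0 ∷ []) ∷
    (-1 ∷  0 ∷  0 ∷  0 ∷  1 ∷  0 ∷  0 ∷  0 ∷  0 ∷  0 ∷  0 ∷  0 ∷  0 ∷ []) ∷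
    (-1 ∷  0 ∷  0 ∷  0 ∷  0 ∷  1 ∷  0 ∷  0 ∷  0 ∷  0 ∷  0 ∷  0 ∷  0 ∷ []) ∷
    ( 0 ∷  0 ∷  0 ∷  0 ∷  0 ∷  1 ∷ -1 ∷  0 ∷  0 ∷  0 ∷  0 ∷  0 ∷  0 ∷ []) ∷
    []

  combination : ∀ s t → lincomb (lookup (lookup coefficients s)) (λ k → homog (χ (family k))) t ≡ basis s t
  combination = toWitness {a? = all? λ s → all? λ t →
    lincomb (lookup (lookup coefficients s)) (λ k → homog (χ (family k))) t ℚP.≟ basis s t} _

  witnesses : Witnesses 2
  witnesses = record
    { family  = family
    ; spans   = basis⇒span λ s → ext (combination s)
                  (span-∑ _ (λ k → span-* (lookup (lookup coefficients s) k) (gen k)))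
    ; offFace = λ ()
    ; onFace  = toWitness {a? = all? λ t → dotᶜ 2 (family (suc t)) ℚP.≟ rhsᶜ 2} _
    }

-- Facets from spanning families

dot-lincomb : ∀ {n K} (π : Pt n) (μ : Fin K → ℚ) (y : Fin K → Pt n) →
  dot π (λ i j → ∑ (λ k → μ k * y k i j)) ≡ ∑ (λ k → μ k * dot π (y k))
dot-lincomb {n} {K} π μ y = begin
  ∑ (λ i → ∑ (λ j → if ⌊ i ≟ j ⌋ then 0ℚ else π i j * ∑ (λ k → μ k * y k i j)))
    ≡⟨ ∑-cong (λ i → ∑-cong (λ j → term-lincomb i j)) ⟩
  ∑ (λ i → ∑ (λ j → ∑ (λ k → μ k * T k i j)))
    ≡⟨ ∑-cong (λ i → ∑-comm (λ j k → μ k * T k i j)) ⟩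
  ∑ (λ i → ∑ (λ k → ∑ (λ j → μ k * T k i j)))
    ≡⟨ ∑-comm (λ i k → ∑ (λ j → μ k * T k i j)) ⟩
  ∑ (λ k → ∑ (λ i → ∑ (λ j → μ k * T k i j)))
    ≡⟨ ∑-cong (λ k → trans (∑-cong (λ i → sym (*-distribˡ-∑ (μ k) (T k i)))) (sym (*-distribˡ-∑ (μ k) (λ i → ∑ (T k i))))) ⟩
  ∑ (λ k → μ k * dot π (y k)) ∎
  where
  open ≡-Reasoning
  T : Fin K → Fin n → Fin n → ℚ
  T k i j = if ⌊ i ≟ j ⌋ then 0ℚ else π i j * y k i j
  term-lincomb : ∀ i j → (if ⌊ i ≟ j ⌋ then 0ℚ else π i j * ∑ (λ k → μ k * y k i j)) ≡ ∑ (λ k → μ k * T k i j)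
  term-lincomb i j with ⌊ i ≟ j ⌋
  ... | true  = sym (∑-zero (λ k → ℚP.*-zeroʳ (μ k)))
  ... | false = trans (*-distribˡ-∑ (π i j) (λ k → μ k * y k i j))
      (∑-cong (λ k → solve 3 (λ p m y → p :* (m :* y) := m :* (p :* y)) refl (π i j) (μ k) (y k i j)))

dot-zero : ∀ {n} (π : Pt n) → dot π (λ _ _ → 0ℚ) ≡ 0ℚ
dot-zero π = ∑-zero (λ i → ∑-zero (λ j → term-zero i j))
  where
  term-zero : ∀ i j → (if ⌊ i ≟ j ⌋ then 0ℚ else π i j * 0ℚ) ≡ 0ℚ
  term-zero i j with ⌊ i ≟ j ⌋
  ... | true  = refl
  ... | false = ℚP.*-zeroʳ (π i j)

χ∈PWO : ∀ {n} (W : WeakOrder n) → InPWO n (χ W)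
χ∈PWO W = 1 , (λ _ → 1ℚ) , (λ _ → W) , (λ _ → 𝟙-nonNeg true) , refl ,
  λ i j → sym (trans (ℚP.+-identityʳ _) (ℚP.*-identityˡ _))

PWO-diagonal : ∀ {n} x → InPWO n x → ∀ i → x i i ≡ 0ℚ
PWO-diagonal x (K , μ , W , _ , _ , x≡) i =
  trans (x≡ i i) (∑-zero (λ k → trans (cong (λ b → μ k * (if b then 0ℚ else _)) (⌊refl⌋ i)) (ℚP.*-zeroʳ (μ k))))

valid-on-vertices⇒valid : ∀ {n} (π : Pt n) (r : ℚ) → (∀ W → dot π (χ W) ≤ r) → ∀ x → InPWO n x → dot π x ≤ r
valid-on-vertices⇒valid π r valid x (K , μ , W , μ≥0 , ∑μ≡1 , x≡) = begin
  dot π x                         ≡⟨ dot-cong {π = π} (λ _ _ → refl) x≡ ⟩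
  dot π (λ i j → ∑ (λ k → μ k * χ (W k) i j))     ≡⟨ dot-lincomb π μ (λ k → χ (W k)) ⟩
  ∑ (λ k → μ k * dot π (χ (W k)))  ≤⟨ ∑-mono-≤ (λ k → ℚP.*-monoˡ-≤-nonNeg (μ k) {{ℚ.nonNegative (μ≥0 k)}} (valid (W k))) ⟩
  ∑ (λ k → μ k * r)               ≡⟨ *-distribʳ-∑ r μ ⟨
  ∑ μ * r                         ≡⟨ cong (_* r) ∑μ≡1 ⟩
  1ℚ * r                          ≡⟨ ℚP.*-identityˡ r ⟩
  r                               ∎
  where open ℚP.≤-Reasoning

-- The off-diagonal entries of x are exactly its arc coordinates.
arcs-determine : ∀ {n K} (p : Fin K → Pt n) (c : Fin K → ℚ) → (∀ k i → p k i i ≡ 0ℚ) →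
  (∀ t → lincomb c (λ k → homog (p k)) (suc t) ≡ 0ℚ) → ∀ i j → ∑ (λ k → c k * p k i j) ≡ 0ℚ
arcs-determine p c diag zero-on-arcs i j with i ≟ j
... | yes refl = ∑-zero (λ k → trans (cong (c k *_) (diag k i)) (ℚP.*-zeroʳ (c k)))
... | no i≢j with arc-surjective i j i≢j
...   | t , arc≡ = trans (∑-cong (λ k → cong (λ q → c k * p k (proj₁ q) (proj₂ q)) (sym arc≡))) (zero-on-arcs t)

homogIndependent⇒affinelyIndependent : ∀ {n K} (p : Fin K → Pt n) →
  (∀ c → (∀ t → lincomb c (λ k → homog (p k)) t ≡ 0ℚ) → ∀ k → c k ≡ 0ℚ) → AffinelyIndependent p
homogIndependent⇒affinelyIndependent p indep c ∑c≡0 c∙p≡0 = indep c c∙homog≡0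
  where
  c∙homog≡0 : ∀ t → lincomb c (λ k → homog (p k)) t ≡ 0ℚ
  c∙homog≡0 zero    = trans (∑-cong (λ k → ℚP.*-identityʳ (c k))) ∑c≡0
  c∙homog≡0 (suc t) = c∙p≡0 (proj₁ (arc t)) (proj₂ (arc t))

too-many⇒¬affinelyIndependent : ∀ {n} (p : Fin (suc (suc (arcs n))) → Pt n) → (∀ k i → p k i i ≡ 0ℚ) →
  ¬ AffinelyIndependent p
too-many⇒¬affinelyIndependent {n} p diag indep = c≢0 (indep c ∑c≡0 c∙p≡0 k)
  where
  dependence = <⇒linearlyDependent (suc (arcs n)) (suc (suc (arcs n))) (ℕP.n<1+n _) (λ k → homog (p k))
  c = proj₁ dependence
  c∙homog≡0 = proj₁ (proj₂ dependence)
  k = proj₁ (proj₂ (proj₂ dependence))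
  c≢0 = proj₂ (proj₂ (proj₂ dependence))
  ∑c≡0 : ∑ c ≡ 0ℚ
  ∑c≡0 = trans (∑-cong (λ t → sym (ℚP.*-identityʳ (c t)))) (c∙homog≡0 zero)
  c∙p≡0 = arcs-determine p c diag (c∙homog≡0 ∘ suc)

-- On a hyperplane missing the origin the homogenising coordinate is a combination of the others,
-- so one point fewer suffices.
hyperplane⇒¬affinelyIndependent : ∀ {n} (π : Pt n) {r} → r ≢ 0ℚ → (p : Fin (suc (arcs n)) → Pt n) →
  (∀ k i → p k i i ≡ 0ℚ) → (∀ k → dot π (p k) ≡ r) → ¬ AffinelyIndependent p
hyperplane⇒¬affinelyIndependent {n} π {r} r≢0 p diag on-hyperplane indep = c≢0 (indep c ∑c≡0 c∙p≡0 k)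
  where
  dependence = <⇒linearlyDependent (arcs n) (suc (arcs n)) (ℕP.n<1+n _) (λ k t → p k (proj₁ (arc t)) (proj₂ (arc t)))
  c = proj₁ dependence
  k = proj₁ (proj₂ (proj₂ dependence))
  c≢0 = proj₂ (proj₂ (proj₂ dependence))
  c∙p≡0 = arcs-determine p c diag (proj₁ (proj₂ dependence))
  r∑c≡0 : r * ∑ c ≡ 0ℚ
  r∑c≡0 = begin
    r * ∑ c                          ≡⟨ *-distribˡ-∑ r c ⟩
    ∑ (λ k → r * c k)                ≡⟨ ∑-cong (λ k → trans (ℚP.*-comm r (c k)) (cong (c k *_) (sym (on-hyperplane k)))) ⟩
    ∑ (λ k → c k * dot π (p k))      ≡⟨ dot-lincomb π c p ⟨
    dot π (λ i j → ∑ (λ k → c k * p k i j)) ≡⟨ dot-cong {π = π} (λ _ _ → refl) c∙p≡0 ⟩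
    dot π (λ _ _ → 0ℚ)               ≡⟨ dot-zero π ⟩
    0ℚ                               ∎
    where open ≡-Reasoning
  ∑c≡0 = *-cancelˡ-≡0 r≢0 r∑c≡0

facet-criterion : ∀ {n} (π : Pt (2 ℕ.+ n)) {r} → r ≢ 0ℚ → (∀ W → dot π (χ W) ≤ r) →
  (fam : Fin (suc (arcs (2 ℕ.+ n))) → WeakOrder (2 ℕ.+ n)) → (∀ v → Span (λ t → homog (χ (fam t))) v) →
  dot π (χ (fam zero)) ≢ r → (∀ t → dot π (χ (fam (suc t))) ≡ r) →
  FacetDefining (InPWO (2 ℕ.+ n)) π r
facet-criterion {n} π {r} r≢0 valid fam spans off on =
  valid-on-vertices⇒valid π r valid ,
  (χ (fam (suc zero)) , χ∈PWO (fam (suc zero)) , on zero) ,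
  (χ (fam zero) , χ∈PWO (fam zero) , off) ,
  ℕ.pred (arcs N) ,
  ((χ ∘ fam , χ∈PWO ∘ fam , homogIndependent⇒affinelyIndependent (χ ∘ fam) independent) ,
   λ p p∈P → too-many⇒¬affinelyIndependent p (λ k → PWO-diagonal (p k) (p∈P k))) ,
  ((χ ∘ fam ∘ suc , (λ t → χ∈PWO (fam (suc t)) , on t) ,
    homogIndependent⇒affinelyIndependent (χ ∘ fam ∘ suc) λ c′ c′∙homog≡0 t →
      independent (pad c′) (pad-lincomb c′ c′∙homog≡0) (suc t)) ,
   λ p p∈F → hyperplane⇒¬affinelyIndependent π r≢0 p (λ k → PWO-diagonal (p k) (proj₁ (p∈F k))) (proj₂ ∘ p∈F))
  where
  N = 2 ℕ.+ n
  u : Fin (suc (arcs N)) → Fin (suc (arcs N)) → ℚ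
  u t = homog (χ (fam t))
  independent : ∀ c → (∀ t → lincomb c u t ≡ 0ℚ) → ∀ k → c k ≡ 0ℚ
  independent = spanning⇒independent u (λ s → Span⇒InSpan (spans (basis s)))
  pad : (Fin (arcs N) → ℚ) → Fin (suc (arcs N)) → ℚ
  pad c′ zero    = 0ℚ
  pad c′ (suc t) = c′ t
  pad-lincomb : ∀ c′ → (∀ t → lincomb c′ (u ∘ suc) t ≡ 0ℚ) → ∀ t → lincomb (pad c′) u t ≡ 0ℚ
  pad-lincomb c′ c′∙u≡0 t = trans (cong (_+ lincomb c′ (u ∘ suc) t) (ℚP.*-zeroˡ (u zero t)))
                                  (trans (ℚP.+-identityˡ _) (c′∙u≡0 t))

-- The right-hand side

fromℚᵘ-homo-+ : ∀ p q → ℚ.fromℚᵘ (p ℚᵘ.+ q) ≡ ℚ.fromℚᵘ p + ℚ.fromℚᵘ q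
fromℚᵘ-homo-+ p q = ℚP.toℚᵘ-injective (ℚᵘP.≃-trans (ℚP.toℚᵘ-fromℚᵘ (p ℚᵘ.+ q))
  (ℚᵘP.≃-sym (ℚᵘP.≃-trans (ℚP.toℚᵘ-homo-+ (ℚ.fromℚᵘ p) (ℚ.fromℚᵘ q))
                          (ℚᵘP.+-cong (ℚP.toℚᵘ-fromℚᵘ p) (ℚP.toℚᵘ-fromℚᵘ q)))))

module _ where
  open ℤSolver using () renaming (solve to solveℤ; _:+_ to _⊕_; _:*_ to _⊗_; _:=_ to _⊜_; con to ι)

  half-+ : ∀ a b → (ℤ.+ (a ℕ.+ (b ℕ.+ b))) / 2 ≡ (ℤ.+ a) / 2 + (ℤ.+ b) / 1
  half-+ a b = trans (ℚP.fromℚᵘ-cong {ℚᵘ.mkℚᵘ (ℤ.+ (a ℕ.+ (b ℕ.+ b))) 1} {ℚᵘ.mkℚᵘ (ℤ.+ a) 1 ℚᵘ.+ ℚᵘ.mkℚᵘ (ℤ.+ b) 0} (ℚᵘ.*≡* (trans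
      (cong (ℤ._* ℤ.+ 2) (trans (ℤP.pos-+ a (b ℕ.+ b)) (cong (λ z → ℤ.+ a ℤ.+ z) (ℤP.pos-+ b b))))
      (solveℤ 2 (λ A B → (A ⊕ (B ⊕ B)) ⊗ ι (ℤ.+ 2) ⊜ (A ⊗ ι (ℤ.+ 1) ⊕ B ⊗ ι (ℤ.+ 2)) ⊗ ι (ℤ.+ 2))
             refl (ℤ.+ a) (ℤ.+ b)))))
    (fromℚᵘ-homo-+ (ℚᵘ.mkℚᵘ (ℤ.+ a) 1) (ℚᵘ.mkℚᵘ (ℤ.+ b) 0))

  ⟨⟩≡/1 : ∀ m → ⟨ m ⟩ ≡ (ℤ.+ m) / 1
  ⟨⟩≡/1 zero    = refl
  ⟨⟩≡/1 (suc m) = sym (trans (ℚP.fromℚᵘ-cong {ℚᵘ.mkℚᵘ (ℤ.+ suc m) 0} {ℚᵘ.mkℚᵘ (ℤ.+ 1) 0 ℚᵘ.+ ℚᵘ.mkℚᵘ (ℤ.+ m) 0} (ℚᵘ.*≡* (trans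
      (cong (ℤ._* ℤ.+ 1) (ℤP.pos-+ 1 m))
      (solveℤ 1 (λ M → (ι (ℤ.+ 1) ⊕ M) ⊗ ι (ℤ.+ 1) ⊜ (ι (ℤ.+ 1) ⊗ ι (ℤ.+ 1) ⊕ M ⊗ ι (ℤ.+ 1)) ⊗ ι (ℤ.+ 1))
             refl (ℤ.+ m)))))
    (trans (fromℚᵘ-homo-+ (ℚᵘ.mkℚᵘ (ℤ.+ 1) 0) (ℚᵘ.mkℚᵘ (ℤ.+ m) 0)) (cong (1ℚ +_) (sym (⟨⟩≡/1 m)))))

rhsthm≡rhsᶜ : ∀ k → rhsthm (4 ℕ.+ k) ≡ rhsᶜ (2 ℕ.+ k)
rhsthm≡rhsᶜ zero    = refl
rhsthm≡rhsᶜ (suc k) = begin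
  two - half ((2 ℕ.+ k) ℕ.* (1 ℕ.+ k))
    ≡⟨ cong (λ z → two - half z) (solveℕ 1 (λ k → (ι 2 ⊕ k) ⊗ (ι 1 ⊕ k) ⊜ (ι 1 ⊕ k) ⊗ k ⊕ ((ι 1 ⊕ k) ⊕ (ι 1 ⊕ k))) refl k) ⟩
  two - half ((1 ℕ.+ k) ℕ.* k ℕ.+ ((1 ℕ.+ k) ℕ.+ (1 ℕ.+ k)))
    ≡⟨ cong (λ z → two - z) (half-+ ((1 ℕ.+ k) ℕ.* k) (1 ℕ.+ k)) ⟩
  two - (half ((1 ℕ.+ k) ℕ.* k) + (ℤ.+ (1 ℕ.+ k)) / 1)
    ≡⟨ solve 3 (λ t x y → t :- (x :+ y) := (t :- x) :+ (con 1ℚ :- (con 1ℚ :+ y))) refl two (half ((1 ℕ.+ k) ℕ.* k)) ((ℤ.+ (1 ℕ.+ k)) / 1) ⟩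
  (two - half ((1 ℕ.+ k) ℕ.* k)) + (1ℚ - (1ℚ + (ℤ.+ (1 ℕ.+ k)) / 1))
    ≡⟨ cong₂ (λ x y → x + (1ℚ - (1ℚ + y))) (rhsthm≡rhsᶜ k) (sym (⟨⟩≡/1 (1 ℕ.+ k))) ⟩
  rhsᶜ (3 ℕ.+ k) ∎
  where
  open ≡-Reasoning
  open ℕSolver using () renaming (solve to solveℕ; _:+_ to _⊕_; _:*_ to _⊗_; _:=_ to _⊜_; con to ι)
  two = (ℤ.+ 2) / 1
  half : ℕ → ℚ
  half a = (ℤ.+ a) / 2

rhsᶜ≤-1 : ∀ k → rhsᶜ (4 ℕ.+ k) ≤ - 1ℚ
rhsᶜ≤-1 zero    = ℚP.≤-refl
rhsᶜ≤-1 (suc k) = begin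
  rhsᶜ (4 ℕ.+ k) + (1ℚ - ⟨ 4 ℕ.+ k ⟩)  ≤⟨ ℚP.+-monoʳ-≤ (rhsᶜ (4 ℕ.+ k)) (ℚP.+-monoʳ-≤ 1ℚ (ℚP.neg-antimono-≤ 1≤⟨4+k⟩)) ⟩
  rhsᶜ (4 ℕ.+ k) + (1ℚ - 1ℚ)          ≡⟨ ℚP.+-identityʳ (rhsᶜ (4 ℕ.+ k)) ⟩
  rhsᶜ (4 ℕ.+ k)                      ≤⟨ rhsᶜ≤-1 k ⟩
  - 1ℚ                                ∎
  where
  open ℚP.≤-Reasoning
  1≤⟨4+k⟩ : 1ℚ ≤ ⟨ 4 ℕ.+ k ⟩
  1≤⟨4+k⟩ = ℚP.≤-trans (ℚP.≤-reflexive (sym (ℚP.+-identityʳ 1ℚ)))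
                      (ℚP.+-monoʳ-≤ 1ℚ (∑-nonNeg {3 ℕ.+ k} (λ _ → 1ℚ) (λ _ → 𝟙-nonNeg true)))

rhsᶜ≢0 : ∀ k → rhsᶜ (2 ℕ.+ k) ≢ 0ℚ
rhsᶜ≢0 zero          ()
rhsᶜ≢0 (suc zero)    ()
rhsᶜ≢0 (suc (suc k)) rhs≡0 with subst (_≤ - 1ℚ) rhs≡0 (rhsᶜ≤-1 k)
... | ℚ.*≤* ()

witnesses : ∀ k → Witnesses (2 ℕ.+ k)
witnesses zero    = BaseCase.witnesses
witnesses (suc k) = Step.step (suc k) (witnesses k)

canonical-facet : ∀ k → FacetDefining (InPWO (4 ℕ.+ k)) (πᶜ (2 ℕ.+ k)) (rhsthm (4 ℕ.+ k))
canonical-facet k rewrite rhsthm≡rhsᶜ k =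
  facet-criterion (πᶜ (2 ℕ.+ k)) (rhsᶜ≢0 k) (proj₁ ∘ valid (2 ℕ.+ k)) family spans offFace onFace
  where open Witnesses (witnesses k)

-- Relabelling the ground set

module Relabel {n : ℕ} (σ : Permutation′ n) where

  relabel : ∀ {A : Set} → (Fin n → Fin n → A) → Fin n → Fin n → A
  relabel x i j = x (σ ⟨$⟩ʳ i) (σ ⟨$⟩ʳ j)

  ⌊σ⌋ : ∀ i j → ⌊ σ ⟨$⟩ʳ i ≟ σ ⟨$⟩ʳ j ⌋ ≡ ⌊ i ≟ j ⌋
  ⌊σ⌋ i j with i ≟ j
  ... | yes i≡j = ⌊yes⌋ (cong (σ ⟨$⟩ʳ_) i≡j)
  ... | no i≢j  = ⌊no⌋ (λ e → i≢j (trans (sym (inverseˡ σ)) (trans (cong (σ ⟨$⟩ˡ_) e) (inverseˡ σ))))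

  dot-relabel : ∀ (π x : Pt n) → dot (relabel π) (relabel x) ≡ dot π x
  dot-relabel π x = trans (∑-cong (λ i → trans (∑-cong (λ j → cong (λ b → if b then 0ℚ else relabel π i j * relabel x i j) (sym (⌊σ⌋ i j))))
                                                (∑-permute σ (λ j → term (σ ⟨$⟩ʳ i) j))))
                          (∑-permute σ (λ i → ∑ (term i)))
    where
    term : Fin n → Fin n → ℚ
    term i j = if ⌊ i ≟ j ⌋ then 0ℚ else π i j * x i j

  relabelWO : WeakOrder n → WeakOrder n
  relabelWO W = record
    { R     = relabel (R W)
    ; refl  = λ i → WeakOrder.refl W (σ ⟨$⟩ʳ i)
    ; trans = λ i j k → WeakOrder.trans W (σ ⟨$⟩ʳ i) (σ ⟨$⟩ʳ j) (σ ⟨$⟩ʳ k)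
    ; total = λ i j → WeakOrder.total W (σ ⟨$⟩ʳ i) (σ ⟨$⟩ʳ j)
    }

  relabel-PWO : ∀ x → InPWO n x → InPWO n (relabel x)
  relabel-PWO x (K , μ , W , μ≥0 , ∑μ≡1 , x≡) = K , μ , relabelWO ∘ W , μ≥0 , ∑μ≡1 ,
    λ i j → trans (x≡ (σ ⟨$⟩ʳ i) (σ ⟨$⟩ʳ j)) (∑-cong (λ k → cong (μ k *_)
      (cong (λ b → if b then 0ℚ else pref (W k) (σ ⟨$⟩ʳ i) (σ ⟨$⟩ʳ j)) (⌊σ⌋ i j))))

  relabel-affinelyIndependent : ∀ {K} (p : Fin K → Pt n) → AffinelyIndependent p →
    AffinelyIndependent (λ k → relabel (p k))
  relabel-affinelyIndependent p indep c ∑c≡0 c∙p≡0 = indep c ∑c≡0 λ i j →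
    subst₂ (λ a b → ∑ (λ k → c k * p k a b) ≡ 0ℚ) (inverseʳ σ) (inverseʳ σ) (c∙p≡0 (σ ⟨$⟩ˡ i) (σ ⟨$⟩ˡ j))

  πthm-relabel : ∀ a b i j → πthm (σ ⟨$⟩ʳ a) (σ ⟨$⟩ʳ b) (σ ⟨$⟩ʳ i) (σ ⟨$⟩ʳ j) ≡ πthm a b i j
  πthm-relabel a b i j rewrite ⌊σ⌋ i j | ⌊σ⌋ i a | ⌊σ⌋ i b | ⌊σ⌋ j a | ⌊σ⌋ j b = refl

relabel-facet : ∀ {n} (σ : Permutation′ n) (π : Pt n) {π₀ : Pt n} {r} → (∀ i j → π (σ ⟨$⟩ʳ i) (σ ⟨$⟩ʳ j) ≡ π₀ i j) →
  FacetDefining (InPWO n) π₀ r → FacetDefining (InPWO n) π r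
relabel-facet {n} σ π {π₀} {r} π≡ (valid , (y , y∈P , y-on) , (z , z∈P , z-off) , d , (dimP , dimP′) , (dimF , dimF′)) =
  (λ x x∈P → ℚP.≤-trans (ℚP.≤-reflexive (dot-π x)) (valid (S.relabel x) (S.relabel-PWO x x∈P))) ,
  (S⁻¹.relabel y , S⁻¹.relabel-PWO y y∈P , trans (back y) y-on) ,
  (S⁻¹.relabel z , S⁻¹.relabel-PWO z z∈P , z-off ∘ trans (sym (back z))) ,
  d ,
  ((S⁻¹.relabel ∘ proj₁ dimP , (λ t → S⁻¹.relabel-PWO _ (proj₁ (proj₂ dimP) t)) ,
    S⁻¹.relabel-affinelyIndependent (proj₁ dimP) (proj₂ (proj₂ dimP))) ,
   λ p p∈P indep → dimP′ (S.relabel ∘ p) (λ t → S.relabel-PWO (p t) (p∈P t)) (S.relabel-affinelyIndependent p indep)) ,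
  ((S⁻¹.relabel ∘ proj₁ dimF ,
    (λ t → S⁻¹.relabel-PWO _ (proj₁ (proj₁ (proj₂ dimF) t)) , trans (back (proj₁ dimF t)) (proj₂ (proj₁ (proj₂ dimF) t))) ,
    S⁻¹.relabel-affinelyIndependent (proj₁ dimF) (proj₂ (proj₂ dimF))) ,
   λ p p∈F indep → dimF′ (S.relabel ∘ p) (λ t → S.relabel-PWO (p t) (proj₁ (p∈F t)) , trans (sym (dot-π (p t))) (proj₂ (p∈F t)))
                         (S.relabel-affinelyIndependent p indep))
  where
  module S   = Relabel σ
  module S⁻¹ = Relabel (Perm.flip σ)
  dot-π : ∀ x → dot π x ≡ dot π₀ (S.relabel x)
  dot-π x = trans (sym (S.dot-relabel π x)) (dot-cong π≡ (λ _ _ → refl))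
  back : ∀ y → dot π (S⁻¹.relabel y) ≡ dot π₀ y
  back y = trans (dot-π (S⁻¹.relabel y)) (dot-cong {π = π₀} (λ _ _ → refl) (λ i j → cong₂ y (inverseˡ σ) (inverseˡ σ)))

transpose-matchˡ : ∀ {n} (i j : Fin n) → Perm.transpose i j ⟨$⟩ʳ i ≡ j
transpose-matchˡ i j rewrite dec-true (i ≟ i) refl = refl

transpose-fix : ∀ {n} {i j k : Fin n} → k ≢ i → k ≢ j → Perm.transpose i j ⟨$⟩ʳ k ≡ k
transpose-fix {i = i} {j} {k} k≢i k≢j rewrite dec-false (k ≟ i) k≢i | dec-false (k ≟ j) k≢j = refl

permutation-sending : ∀ {n} {a b i₁ i₂ : Fin n} → a ≢ b → i₁ ≢ i₂ →
  Σ (Permutation′ n) λ σ → σ ⟨$⟩ʳ a ≡ i₁ × σ ⟨$⟩ʳ b ≡ i₂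
permutation-sending {a = a} {b} {i₁} {i₂} a≢b i₁≢i₂ =
  σ₁ ∘ₚ σ₂ , trans (cong (σ₂ ⟨$⟩ʳ_) (transpose-matchˡ a i₁)) (transpose-fix i₁≢b′ i₁≢i₂) , transpose-matchˡ b′ i₂
  where
  σ₁ = Perm.transpose a i₁
  b′ = σ₁ ⟨$⟩ʳ b
  σ₂ = Perm.transpose b′ i₂
  i₁≢b′ : i₁ ≢ b′
  i₁≢b′ e = a≢b (trans (sym (inverseˡ σ₁)) (trans (cong (σ₁ ⟨$⟩ˡ_) (trans (transpose-matchˡ a i₁) e)) (inverseˡ σ₁)))

theorem11 : (n : ℕ) → 4 ℕ.≤ n → (i₁ i₂ : Fin n) → i₁ ≢ i₂ →
    FacetDefining (InPWO n) (πthm i₁ i₂) (rhsthm n)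
theorem11 (suc (suc (suc (suc k)))) (s≤s (s≤s (s≤s (s≤s z≤n)))) i₁ i₂ i₁≢i₂
  with permutation-sending (I₁≢I₂ (2 ℕ.+ k)) i₁≢i₂
... | σ , refl , refl = relabel-facet σ (πthm i₁ i₂) (Relabel.πthm-relabel σ (I₁ (2 ℕ.+ k)) (I₂ (2 ℕ.+ k))) (canonical-facet k)
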